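{- Let $G$ be a finite simple group. Then for every positive integer $n$ divisible by $|G|^2$ there exists $s\in G\backslash\operatorname{Sur}_1(F_n,G)$ such that the image of the stabilizer of $s$ under $B_n\to S_n$ contains an $n$-cycle.
   Context: $\operatorname{Sur}_1(F_n,G)$ is identified with the set of $(g_1,\dots,g_n)\in G^n$ with $\langle g_1,\dots,g_n\rangle=G$ and $g_1\cdots g_n=1$. $B_n$ acts on it from the right by $(\dots,g_i,g_{i+1},\dots)^{\sigma_i}=(\dots,g_{i+1},g_{i+1}^{ -1}g_ig_{i+1},\dots)$; $G$ acts on the left by simultaneous conjugation, commuting with the $B_n$-action, and $G\backslash\operatorname{Sur}_1(F_n,G)$ is the set of $G$-orbits with the induced $B_n$-action. $B_n\to S_n$ sends $\sigma_i\mapsto(i\ i+1)$. -}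

module Defs where

open import Data.Nat using (ℕ; zero; suc; _<_)
open import Data.Fin using (Fin; zero; suc; inject₁; _≟_)
open import Data.Bool using (Bool; true)
open import Data.Product using (_×_; Σ; ∃)
open import Data.Sum using (_⊎_)
open import Data.List using (List; []; _∷_)
open import Relation.Nullary using (yes; no)
open import Relation.Binary.PropositionalEquality using (_≡_)
open import Algebra.Structures using (IsGroup)

-- A finite group, presented (up to isomorphism) with carrier Fin order;
-- equality is propositional equality, so |G| = order.
record FiniteGroup : Set where
  field
    order   : ℕ
    _∙_     : Fin order → Fin order → Fin order
    ε       : Fin order
    _⁻¹     : Fin order → Fin order
    isGroup : IsGroup _≡_ _∙_ ε _⁻¹
  infixl 7 _∙_
  infix 8 _⁻¹

module _ (G : FiniteGroup) where
  open FiniteGroup G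

  -- normal subgroups, as (decidable, since G is finite) subsets Fin order → Bool
  IsNormalSubgroup : (Fin order → Bool) → Set
  IsNormalSubgroup N =
    (N ε ≡ true)
    × (∀ x y → N x ≡ true → N y ≡ true → N (x ∙ y) ≡ true)
    × (∀ x → N x ≡ true → N (x ⁻¹) ≡ true)
    × (∀ g x → N x ≡ true → N (g ∙ x ∙ g ⁻¹) ≡ true)

  IsSimple : Set
  IsSimple = (1 < order)
    × (∀ N → IsNormalSubgroup N → (∀ x → N x ≡ true → x ≡ ε) ⊎ (∀ x → N x ≡ true))

  data Gen {n : ℕ} (g : Fin n → Fin order) : Fin order → Set where
    gen  : ∀ i → Gen g (g i)
    unit : Gen g ε
    mul  : ∀ {x y} → Gen g x → Gen g y → Gen g (x ∙ y)
    inv  : ∀ {x} → Gen g x → Gen g (x ⁻¹)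

  Generates : ∀ {n} → (Fin n → Fin order) → Set
  Generates g = ∀ x → Gen g x

  prod : ∀ {n} → (Fin n → Fin order) → Fin order
  prod {zero}  g = ε
  prod {suc n} g = g zero ∙ prod (λ i → g (suc i))

  InSur1 : ∀ {n} → (Fin n → Fin order) → Set
  InSur1 g = Generates g × (prod g ≡ ε)

-- Braid generators of B_n: σ i, σ⁻¹ i for i : Fin m, n = suc m;
-- σ i stands for σ_{i+1}, acting on positions inject₁ i and suc i.
data Letter : ℕ → Set where
  σ   : ∀ {m} → Fin m → Letter (suc m)
  σ⁻¹ : ∀ {m} → Fin m → Letter (suc m)

Braid : ℕ → Set
Braid n = List (Letter n)

module _ (G : FiniteGroup) where
  open FiniteGroup G

  actLetter : ∀ {n} → Letter n → (Fin n → Fin order) → (Fin n → Fin order)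
  actLetter (σ i) g j with j ≟ inject₁ i | j ≟ suc i
  ... | yes _ | _     = g (suc i)
  ... | no _  | yes _ = g (suc i) ⁻¹ ∙ g (inject₁ i) ∙ g (suc i)
  ... | no _  | no _  = g j
  actLetter (σ⁻¹ i) g j with j ≟ inject₁ i | j ≟ suc i
  ... | yes _ | _     = g (inject₁ i) ∙ g (suc i) ∙ g (inject₁ i) ⁻¹
  ... | no _  | yes _ = g (inject₁ i)
  ... | no _  | no _  = g j

  act : ∀ {n} → Braid n → (Fin n → Fin order) → (Fin n → Fin order)
  act []      g = g
  act (l ∷ w) g = act w (actLetter l g)

swapLetter : ∀ {n} → Letter n → Fin n → Fin n
swapLetter (σ i) j with j ≟ inject₁ i | j ≟ suc i
... | yes _ | _     = suc i
... | no _  | yes _ = inject₁ i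
... | no _  | no _  = j
swapLetter (σ⁻¹ i) j with j ≟ inject₁ i | j ≟ suc i
... | yes _ | _     = suc i
... | no _  | yes _ = inject₁ i
... | no _  | no _  = j

perm : ∀ {n} → Braid n → Fin n → Fin n
perm []      j = j
perm (l ∷ w) j = perm w (swapLetter l j)

iter : ∀ {A : Set} → (A → A) → ℕ → A → A
iter f zero    a = a
iter f (suc k) a = f (iter f k a)

-- π ∈ S_n is an n-cycle: ⟨π⟩ acts transitively on {1,…,n}
IsNCycle : ∀ {n} → (Fin n → Fin n) → Set
IsNCycle {n} π = ∀ i j → ∃ λ k → iter π k i ≡ j

-- Write N = |G|, n = qN², L = qN, and fix x ≠ 1. The tuple consists of N blocks of
-- L equal entries, one block for each conjugate b x b⁻¹ (b ∈ G). By Lagrange every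
-- v ∈ G satisfies v^L = 1, so every block has product 1; hence the tuple has product 1,
-- and it generates G because the conjugates of x generate the simple group G.
-- A block with product 1 can be carried past its neighbours by a braid that changes no
-- entry, and a full twist of a block together with the first entry c of the next block
-- conjugates the block by c. Conjugating the first block by a suitable product of block
-- values makes it equal to any other block; swapping the two equal blocks and undoing
-- the conjugation gives a braid that fixes the tuple and interchanges the two blocks.
-- Composing the rotation of the first block with these interchanges, one for every
-- other block, gives a braid fixing the tuple whose permutation is an n-cycle.

module Submission where

open import Defs
open import Level using (0ℓ)
open import Algebra.Bundles using (Group)
import Algebra.Properties.Group as GroupProperties
import Algebra.Properties.Monoid.Mult as MonoidMult
open import Data.Bool as Bool using (Bool; true; false; _∧_; _∨_; not)
open import Data.Bool.Properties using (¬-not; ∧-conicalˡ; ∧-conicalʳ; ∧-zeroʳ; ∧-identityʳ; ∨-zeroʳ)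
open import Data.Fin as Fin using (Fin; zero; suc; toℕ; inject₁; fromℕ<)
open import Data.Fin.Properties as FinProperties
  using (any?; all?; ¬∀⟶∃¬; pigeonhole; toℕ<n; toℕ-injective; toℕ-inject₁; toℕ-fromℕ<)
open import Data.List using (List; []; _∷_; _++_; [_]; map; length; replicate; tabulate; drop)
open import Data.List.Properties
  using (++-assoc; ++-identityʳ; length-++; length-replicate; length-tabulate; length-drop;
         map-id; map-cong; map-replicate; map-++)
open import Data.List.Relation.Unary.All using (All; []; _∷_)
import Data.List.Relation.Unary.All as All
open import Data.List.Relation.Unary.All.Properties using (++⁺; map⁺)
open import Data.Nat using (ℕ; zero; suc; _+_; _*_; _∸_; _<_; _≤_; z≤n; s≤s; _<?_; _≤?_)
open import Data.Nat.Divisibility using (_∣_; divides; ∣m∣n⇒∣m+n; ∣-refl; _∣0)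
open import Data.Nat.Induction using (<-rec)
open import Data.Nat.Properties
open import Data.Product using (_×_; _,_; proj₁; proj₂; Σ; ∃)
open import Data.Sum using (_⊎_; inj₁; inj₂; [_,_]′)
open import Function using (_∘_; id)
open import Function.Definitions using (Injective)
open import Relation.Binary using (tri<; tri≈; tri>)
open import Relation.Binary.PropositionalEquality hiding ([_])
open import Relation.Nullary using (¬_; Dec; yes; no; does; contradiction; _×-dec_)
open import Relation.Unary using (Decidable)

-- Counting elements of decidable subsets of Fin n

_⊆ᵇ_ : ∀ {n} → (Fin n → Bool) → (Fin n → Bool) → Set
P ⊆ᵇ Q = ∀ i → P i ≡ true → Q i ≡ true

count : ∀ {n} → (Fin n → Bool) → ℕ
count {zero}  P = 0
count {suc n} P with P zero
... | true  = suc (count (P ∘ suc))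
... | false = count (P ∘ suc)

count-≤ : ∀ {n} (P : Fin n → Bool) → count P ≤ n
count-≤ {zero}  P = z≤n
count-≤ {suc n} P with P zero
... | true  = s≤s (count-≤ (P ∘ suc))
... | false = m≤n⇒m≤1+n (count-≤ (P ∘ suc))

count-all : ∀ {n} → count {n} (λ _ → true) ≡ n
count-all {zero}  = refl
count-all {suc n} = cong suc count-all

count-cong : ∀ {n} {P Q : Fin n → Bool} → (∀ i → P i ≡ Q i) → count P ≡ count Q
count-cong {zero}        P≗Q = refl
count-cong {suc n} {P} {Q} P≗Q with P zero | Q zero | P≗Q zero
... | true  | true  | refl = cong suc (count-cong (P≗Q ∘ suc))
... | false | false | refl = count-cong (P≗Q ∘ suc)

count-none : ∀ {n} (P : Fin n → Bool) → (∀ i → P i ≡ false) → count P ≡ 0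
count-none {zero}  P P≡false = refl
count-none {suc n} P P≡false with P zero | P≡false zero
... | false | refl = count-none (P ∘ suc) (P≡false ∘ suc)

count-mono : ∀ {n} {P Q : Fin n → Bool} → P ⊆ᵇ Q → count P ≤ count Q
count-mono {zero}          P⊆Q = z≤n
count-mono {suc n} {P} {Q} P⊆Q with P zero | Q zero | P⊆Q zero
... | true  | true  | _ = s≤s (count-mono (P⊆Q ∘ suc))
... | true  | false | P⊆Q₀ = contradiction (P⊆Q₀ refl) λ ()
... | false | true  | _ = m≤n⇒m≤1+n (count-mono (P⊆Q ∘ suc))
... | false | false | _ = count-mono (P⊆Q ∘ suc)

count-mono-< : ∀ {n} {P Q : Fin n → Bool} → P ⊆ᵇ Q → ∀ i → P i ≡ false → Q i ≡ true → count P < count Q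
count-mono-< {suc n} {P} {Q} P⊆Q zero Pi Qi with P zero | Q zero
count-mono-< P⊆Q zero refl refl | false | true = s≤s (count-mono (P⊆Q ∘ suc))
count-mono-< {suc n} {P} {Q} P⊆Q (suc i) Pi Qi with P zero | Q zero | P⊆Q zero
... | true  | true  | _    = s≤s (count-mono-< (P⊆Q ∘ suc) i Pi Qi)
... | true  | false | P⊆Q₀ = contradiction (P⊆Q₀ refl) λ ()
... | false | true  | _    = m≤n⇒m≤1+n (count-mono-< (P⊆Q ∘ suc) i Pi Qi)
... | false | false | _    = count-mono-< (P⊆Q ∘ suc) i Pi Qi

count-split : ∀ {n} (P Q : Fin n → Bool) →
              count P ≡ count (λ i → P i ∧ Q i) + count (λ i → P i ∧ not (Q i))
count-split {zero}  P Q = refl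
count-split {suc n} P Q with P zero | Q zero
... | false | _     = count-split (P ∘ suc) (Q ∘ suc)
... | true  | true  = cong suc (count-split (P ∘ suc) (Q ∘ suc))
... | true  | false = trans (cong suc (count-split (P ∘ suc) (Q ∘ suc)))
                            (sym (+-suc (count (λ i → P (suc i) ∧ Q (suc i))) _))

count-insert : ∀ {n} (P : Fin n → Bool) a → P a ≡ false →
               count (λ i → does (a Fin.≟ i) ∨ P i) ≡ suc (count P)
count-insert {suc n} P zero Pa with P zero
count-insert P zero refl | false = cong suc (count-cong {P = λ i → P (suc i)} λ i → refl)
count-insert {suc n} P (suc a) Pa with P zero
... | true  = cong suc (count-insert (P ∘ suc) a Pa)
... | false = count-insert (P ∘ suc) a Pa

image : ∀ {k n} → (Fin k → Fin n) → Fin n → Bool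
image f w = does (any? (λ i → f i Fin.≟ w))

image-complete : ∀ {k n} (f : Fin k → Fin n) i → image f (f i) ≡ true
image-complete f i with any? (λ j → f j Fin.≟ f i)
... | yes _ = refl
... | no none = contradiction (i , refl) none

image-sound : ∀ {k n} (f : Fin k → Fin n) w → image f w ≡ true → ∃ λ i → f i ≡ w
image-sound f w w∈f with any? (λ j → f j Fin.≟ w)
... | yes found = found

count-image : ∀ {k n} (f : Fin k → Fin n) → Injective _≡_ _≡_ f → count (image f) ≡ k
count-image {zero}  f f-inj = count-none (image f) (λ _ → refl)
count-image {suc k} f f-inj = begin
  count (image f)
    ≡⟨ count-insert (image (f ∘ suc)) (f zero) f₀∉ ⟩
  suc (count (image (f ∘ suc)))
    ≡⟨ cong suc (count-image (f ∘ suc) (FinProperties.suc-injective ∘ f-inj)) ⟩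
  suc k ∎
  where
  open ≡-Reasoning
  f₀∉ : image (f ∘ suc) (f zero) ≡ false
  f₀∉ with any? (λ i → f (suc i) Fin.≟ f zero)
  ... | yes (i , fᵢ≡f₀) = contradiction (f-inj fᵢ≡f₀) λ ()
  ... | no _ = refl

chain-stabilises : ∀ {n} (S : ℕ → Fin n → Bool) → (∀ k → S k ⊆ᵇ S (suc k)) →
                   ∃ λ k → ∀ i → S (suc k) i ≡ S k i
chain-stabilises {n} S ascending = [ id , too-large ]′ (stable-or-large (suc n))
  where
  too-large : suc n ≤ count (S (suc n)) → ∃ λ k → ∀ i → S (suc k) i ≡ S k i
  too-large large = contradiction (≤-trans large (count-≤ (S (suc n)))) (<-irrefl refl)
  stable-or-large : ∀ k → (∃ λ k → ∀ i → S (suc k) i ≡ S k i) ⊎ (k ≤ count (S k))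
  stable-or-large zero = inj₂ z≤n
  stable-or-large (suc k) with stable-or-large k
  ... | inj₁ stable = inj₁ stable
  ... | inj₂ large with all? (λ i → S (suc k) i Bool.≟ S k i)
  ...   | yes stable = inj₁ (k , stable)
  ...   | no unstable with ¬∀⟶∃¬ n _ (λ i → S (suc k) i Bool.≟ S k i) unstable
  ...     | i , Sᵢ≢ with S k i in old | S (suc k) i in new
  ...       | false | true  = inj₂ (≤-trans (s≤s large) (count-mono-< (ascending k) i old new))
  ...       | false | false = contradiction refl Sᵢ≢
  ...       | true  | true  = contradiction refl Sᵢ≢
  ...       | true  | false = contradiction (trans (sym (ascending k i old)) new) λ ()

least : (P : ℕ → Set) → Decidable P → ∀ {d} → P d → ∃ λ k → P k × (∀ j → j < k → ¬ P j)
least P P? {d} Pd = search 0 d refl (λ _ ())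
  where
  search : ∀ i r → i + r ≡ d → (∀ j → j < i → ¬ P j) → ∃ λ k → P k × (∀ j → j < k → ¬ P j)
  search i r i+r≡d below with P? i
  ... | yes Pi = i , Pi , below
  search i zero i+0≡d below | no ¬Pi = contradiction (subst P (trans (sym i+0≡d) (+-identityʳ i)) Pd) ¬Pi
  search i (suc r) i+r≡d below | no ¬Pi = search (suc i) r (trans (sym (+-suc i r)) i+r≡d) below′
    where
    below′ : ∀ j → j < suc i → ¬ P j
    below′ j (s≤s j≤i) with m≤n⇒m<n∨m≡n j≤i
    ... | inj₁ j<i  = below j j<i
    ... | inj₂ refl = ¬Pi

-- Powers, conjugation, and Lagrange's theorem for cyclic subgroups

module GroupFacts (G : FiniteGroup) where
  open FiniteGroup G public

  group : Group 0ℓ 0ℓ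
  group = record { isGroup = isGroup }

  open Group group public using (Carrier; assoc; identityˡ; identityʳ; inverseˡ; inverseʳ)
  open GroupProperties group public
    using (∙-cancelˡ; ∙-cancelʳ; inverseʳ-unique; ε⁻¹≈ε; ⁻¹-involutive; ⁻¹-anti-homo-∙;
           \\-leftDividesˡ; \\-leftDividesʳ; //-rightDividesˡ; //-rightDividesʳ)
  open MonoidMult (Group.monoid group) using (×-homo-+; ×-assocˡ) renaming (_×_ to _times_)

  infixr 8 _^_
  _^_ : Carrier → ℕ → Carrier
  x ^ k = k times x

  ^-+ : ∀ x m n → x ^ (m + n) ≡ x ^ m ∙ x ^ n
  ^-+ = ×-homo-+

  ^-* : ∀ x m n → (x ^ n) ^ m ≡ x ^ (m * n)
  ^-* = ×-assocˡ

  ε^ : ∀ k → ε ^ k ≡ ε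
  ε^ zero    = refl
  ε^ (suc k) = trans (identityˡ (ε ^ k)) (ε^ k)

  ^-comm : ∀ x k → x ∙ x ^ k ≡ x ^ k ∙ x
  ^-comm x k = begin
    x ^ (1 + k)       ≡⟨ cong (x ^_) (+-comm 1 k) ⟩
    x ^ (k + 1)       ≡⟨ ^-+ x k 1 ⟩
    x ^ k ∙ (x ∙ ε)   ≡⟨ cong (x ^ k ∙_) (identityʳ x) ⟩
    x ^ k ∙ x         ∎
    where open ≡-Reasoning

  ^-cancel : ∀ x {i j} → i ≤ j → x ^ i ≡ x ^ j → x ^ (j ∸ i) ≡ ε
  ^-cancel x {i} {j} i≤j xⁱ≡xʲ = sym (∙-cancelˡ (x ^ i) ε (x ^ (j ∸ i)) (begin
    x ^ i ∙ ε            ≡⟨ identityʳ (x ^ i) ⟩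
    x ^ i                ≡⟨ xⁱ≡xʲ ⟩
    x ^ j                ≡⟨ cong (x ^_) (m+[n∸m]≡n i≤j) ⟨
    x ^ (i + (j ∸ i))    ≡⟨ ^-+ x i (j ∸ i) ⟩
    x ^ i ∙ x ^ (j ∸ i)  ∎))
    where open ≡-Reasoning

  nontrivial-element : 1 < order → ∃ λ x → x ≢ ε
  nontrivial-element 1<order = either-is-nontrivial (Fin.fromℕ< (<-trans (s≤s z≤n) 1<order))
      (Fin.fromℕ< 1<order) 0≢1
    where
    either-is-nontrivial : ∀ a b → a ≢ b → ∃ λ x → x ≢ ε
    either-is-nontrivial a b a≢b with a Fin.≟ ε
    ... | no  a≢ε = a , a≢ε
    ... | yes refl = b , λ b≡ε → a≢b (sym b≡ε)
    0≢1 : Fin.fromℕ< (<-trans (s≤s z≤n) 1<order) ≢ Fin.fromℕ< 1<order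
    0≢1 eq = contradiction
        (trans (sym (FinProperties.toℕ-fromℕ< _)) (trans (cong toℕ eq) (FinProperties.toℕ-fromℕ< 1<order))) λ ()

  infixl 7.5 _^ᶜ_
  _^ᶜ_ : Carrier → Carrier → Carrier
  a ^ᶜ c = c ⁻¹ ∙ a ∙ c

  ^ᶜ-ε : ∀ a → a ^ᶜ ε ≡ a
  ^ᶜ-ε a = trans (cong₂ (λ s t → s ∙ a ∙ t) ε⁻¹≈ε refl) (trans (identityʳ _) (identityˡ a))

  ^ᶜ-^ᶜ : ∀ a c d → a ^ᶜ c ^ᶜ d ≡ a ^ᶜ (c ∙ d)
  ^ᶜ-^ᶜ a c d = begin
    d ⁻¹ ∙ (c ⁻¹ ∙ a ∙ c) ∙ d       ≡⟨ cong (_∙ d) (assoc (d ⁻¹) _ c) ⟨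
    d ⁻¹ ∙ (c ⁻¹ ∙ a) ∙ c ∙ d       ≡⟨ cong (λ t → t ∙ c ∙ d) (assoc (d ⁻¹) (c ⁻¹) a) ⟨
    d ⁻¹ ∙ c ⁻¹ ∙ a ∙ c ∙ d         ≡⟨ assoc _ c d ⟩
    d ⁻¹ ∙ c ⁻¹ ∙ a ∙ (c ∙ d)       ≡⟨ cong (λ t → t ∙ a ∙ (c ∙ d)) (⁻¹-anti-homo-∙ c d) ⟨
    (c ∙ d) ⁻¹ ∙ a ∙ (c ∙ d)        ∎
    where open ≡-Reasoning

  ^ᶜ-self : ∀ a → a ^ᶜ a ≡ a
  ^ᶜ-self a = trans (cong (_∙ a) (inverseˡ a)) (identityˡ a)

  ^ᶜ-absorb : ∀ a c → a ^ᶜ (a ∙ c) ≡ a ^ᶜ c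
  ^ᶜ-absorb a c = trans (sym (^ᶜ-^ᶜ a a c)) (cong (_^ᶜ c) (^ᶜ-self a))

module Lagrange (G : FiniteGroup) (x : Fin (FiniteGroup.order G)) where
  open GroupFacts G
  open ≡-Reasoning

  private
    positive-period : ∃ λ d → 0 < d × x ^ d ≡ ε
    positive-period with pigeonhole (n<1+n order) (λ (k : Fin (suc order)) → x ^ toℕ k)
    ... | i , j , i<j , xⁱ≡xʲ = toℕ j ∸ toℕ i , m<n⇒0<n∸m i<j , ^-cancel x (<⇒≤ i<j) xⁱ≡xʲ

  -- Opaque, since unfolding it would make the type checker run the pigeonhole search.
  opaque
    minimal-period : ∃ λ e → (0 < e × x ^ e ≡ ε) × (∀ d → d < e → ¬ (0 < d × x ^ d ≡ ε))
    minimal-period = least (λ d → 0 < d × x ^ d ≡ ε) (λ d → (0 <? d) ×-dec (x ^ d Fin.≟ ε))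
        (proj₂ positive-period)

  e : ℕ
  e = proj₁ minimal-period

  e>0 : 0 < e
  e>0 = proj₁ (proj₁ (proj₂ minimal-period))

  x^e≡ε : x ^ e ≡ ε
  x^e≡ε = proj₂ (proj₁ (proj₂ minimal-period))

  x^d≢ε : ∀ d → 0 < d → d < e → x ^ d ≢ ε
  x^d≢ε d d>0 d<e x^d≡ε = proj₂ (proj₂ minimal-period) d d<e (d>0 , x^d≡ε)

  orbit : Fin order → Fin order → Bool
  orbit z = image (λ (k : Fin e) → z ∙ x ^ toℕ k)

  count-orbit : ∀ z → count (orbit z) ≡ e
  count-orbit z = count-image _ injective
    where
    injective : ∀ {i j : Fin e} → z ∙ x ^ toℕ i ≡ z ∙ x ^ toℕ j → i ≡ j
    injective {i} {j} eq with <-cmp (toℕ i) (toℕ j)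
    ... | tri≈ _ i≡j _ = toℕ-injective i≡j
    ... | tri< i<j _ _ = contradiction (^-cancel x (<⇒≤ i<j) (∙-cancelˡ z _ _ eq))
                                       (x^d≢ε _ (m<n⇒0<n∸m i<j) (≤-<-trans (m∸n≤m (toℕ j) (toℕ i)) (toℕ<n j)))
    ... | tri> _ _ j<i = contradiction (^-cancel x (<⇒≤ j<i) (∙-cancelˡ z _ _ (sym eq)))
                                       (x^d≢ε _ (m<n⇒0<n∸m j<i) (≤-<-trans (m∸n≤m (toℕ i) (toℕ j)) (toℕ<n i)))

  Closed : (Fin order → Bool) → Set
  Closed S = ∀ z → S z ≡ true → S (z ∙ x) ≡ true

  private
    ∙^-suc : ∀ z k → z ∙ x ^ suc k ≡ z ∙ x ^ k ∙ x
    ∙^-suc z k = trans (cong (z ∙_) (^-comm x k)) (sym (assoc z (x ^ k) x))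

    orbit-∋ : ∀ z k → k < e → orbit z (z ∙ x ^ k) ≡ true
    orbit-∋ z k k<e = subst (λ t → orbit z (z ∙ x ^ t) ≡ true) (FinProperties.toℕ-fromℕ< k<e)
                            (image-complete (λ (j : Fin e) → z ∙ x ^ toℕ j) (Fin.fromℕ< k<e))

    orbit-sound : ∀ z w → orbit z w ≡ true → ∃ λ k → k < e × z ∙ x ^ k ≡ w
    orbit-sound z w w∈O with image-sound _ w w∈O
    ... | k , eq = toℕ k , toℕ<n k , eq

    orbit-⊆ : ∀ S z → Closed S → S z ≡ true → orbit z ⊆ᵇ S
    orbit-⊆ S z closed Sz w w∈O with orbit-sound z w w∈O
    ... | k , _ , refl = S-powers k
      where
      S-powers : ∀ k → S (z ∙ x ^ k) ≡ true
      S-powers zero    = subst (λ t → S t ≡ true) (sym (identityʳ z)) Sz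
      S-powers (suc k) = subst (λ t → S t ≡ true) (sym (∙^-suc z k)) (closed _ (S-powers k))

    orbit-pred : ∀ z w → orbit z (w ∙ x) ≡ true → orbit z w ≡ true
    orbit-pred z w wx∈O with orbit-sound z (w ∙ x) wx∈O
    ... | zero , _ , z∙ε≡wx = subst (λ t → orbit z t ≡ true) (∙-cancelʳ x _ _ (begin
          z ∙ x ^ (e ∸ 1) ∙ x   ≡⟨ ∙^-suc z (e ∸ 1) ⟨
          z ∙ x ^ suc (e ∸ 1)   ≡⟨ cong (λ t → z ∙ x ^ t) (m+[n∸m]≡n e>0) ⟩
          z ∙ x ^ e             ≡⟨ cong (z ∙_) x^e≡ε ⟩
          z ∙ ε                 ≡⟨ z∙ε≡wx ⟩
          w ∙ x                 ∎))
          (orbit-∋ z (e ∸ 1) (subst (e ∸ 1 <_) (m+[n∸m]≡n e>0) (n<1+n (e ∸ 1))))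
    ... | suc k , k<e , eq = subst (λ t → orbit z t ≡ true)
          (∙-cancelʳ x _ _ (trans (sym (∙^-suc z k)) eq)) (orbit-∋ z k (<⇒≤ k<e))

  -- S splits into orbits z, z ∙ x, …, z ∙ x ^ (e ∸ 1), each with exactly e elements.
  e∣count : ∀ S → Closed S → e ∣ count S
  e∣count S closed = <-rec (λ c → ∀ S → count S ≡ c → Closed S → e ∣ c) step _ S refl closed
    where
    step : ∀ c → (∀ {c′} → c′ < c → ∀ S → count S ≡ c′ → Closed S → e ∣ c′) →
           ∀ S → count S ≡ c → Closed S → e ∣ c
    step c rec S refl closed with any? (λ z → S z Bool.≟ true)
    ... | no empty = subst (e ∣_) (sym (count-none S (λ z → ¬-not (empty ∘ (z ,_))))) (e ∣0)
    ... | yes (z , Sz) = subst (e ∣_) (sym count-S) (∣m∣n⇒∣m+n (rec smaller S′ refl closed′) ∣-refl)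
      where
      O = orbit z
      S′ : Fin order → Bool
      S′ w = S w ∧ not (O w)
      z∈O : O z ≡ true
      z∈O = subst (λ t → O t ≡ true) (identityʳ z) (orbit-∋ z 0 e>0)
      count-S : count S ≡ count S′ + e
      count-S = begin
        count S                                 ≡⟨ count-split S O ⟩
        count (λ w → S w ∧ O w) + count S′      ≡⟨ +-comm (count (λ w → S w ∧ O w)) _ ⟩
        count S′ + count (λ w → S w ∧ O w)      ≡⟨ cong (count S′ +_) (count-cong S∧O≗O) ⟩
        count S′ + count O                      ≡⟨ cong (count S′ +_) (count-orbit z) ⟩
        count S′ + e                            ∎
        where
        S∧O≗O : ∀ w → (S w ∧ O w) ≡ O w
        S∧O≗O w with O w in w∈O
        ... | true  = cong (_∧ true) (orbit-⊆ S z closed Sz w w∈O)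
        ... | false = ∧-zeroʳ (S w)
      smaller : count S′ < count S
      smaller = count-mono-< (λ w → ∧-conicalˡ _ _) z
                  (trans (cong (λ t → S z ∧ not t) z∈O) (∧-zeroʳ (S z))) Sz
      closed′ : Closed S′
      closed′ w S′w with O (w ∙ x) in wx∈O
      ... | true  = contradiction (trans (sym (∧-conicalʳ _ _ S′w)) (cong not (orbit-pred z w wx∈O))) λ ()
      ... | false = trans (∧-identityʳ _) (closed w (∧-conicalˡ _ _ S′w))

  x^order≡ε : x ^ order ≡ ε
  x^order≡ε with e∣count (λ _ → true) (λ _ _ → refl)
  ... | divides q order≡q*e = begin
    x ^ order        ≡⟨ cong (x ^_) (trans (sym (count-all {order})) order≡q*e) ⟩
    x ^ (q * e)      ≡⟨ ^-* x q e ⟨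
    (x ^ e) ^ q      ≡⟨ cong (_^ q) x^e≡ε ⟩
    ε ^ q            ≡⟨ ε^ q ⟩
    ε                ∎

module _ (G : FiniteGroup) where
  open GroupFacts G

  ⁻¹-is-power : ∀ a → a ⁻¹ ≡ a ^ (order ∸ 1)
  ⁻¹-is-power a = sym (inverseʳ-unique a _ (begin
    a ∙ a ^ (order ∸ 1)   ≡⟨⟩
    a ^ suc (order ∸ 1)   ≡⟨ cong (a ^_) (m+[n∸m]≡n (n>0 a)) ⟩
    a ^ order             ≡⟨ Lagrange.x^order≡ε G a ⟩
    ε                     ∎))
    where
    open ≡-Reasoning
    n>0 : ∀ {n} → Fin n → 0 < n
    n>0 {suc n} _ = s≤s z≤n

  submonoid-⁻¹-closed : (S : Fin order → Bool) → S ε ≡ true →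
                        (∀ a b → S a ≡ true → S b ≡ true → S (a ∙ b) ≡ true) →
                        ∀ a → S a ≡ true → S (a ⁻¹) ≡ true
  submonoid-⁻¹-closed S S-ε S-∙ a Sa = subst (λ t → S t ≡ true) (sym (⁻¹-is-power a)) (S-powers (order ∸ 1))
    where
    S-powers : ∀ k → S (a ^ k) ≡ true
    S-powers zero    = S-ε
    S-powers (suc k) = S-∙ a (a ^ k) Sa (S-powers k)

  ^-multiple-of-order : ∀ q v → v ^ (q * order) ≡ ε
  ^-multiple-of-order q v = begin
    v ^ (q * order)     ≡⟨ ^-* v q order ⟨
    (v ^ order) ^ q     ≡⟨ cong (_^ q) (Lagrange.x^order≡ε G v) ⟩
    ε ^ q               ≡⟨ ε^ q ⟩
    ε                   ∎
    where open ≡-Reasoning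

-- The normal closure of an element

exists : ∀ {n} → (Fin n → Bool) → Bool
exists P = does (any? (λ i → P i Bool.≟ true))

exists-complete : ∀ {n} (P : Fin n → Bool) i → P i ≡ true → exists P ≡ true
exists-complete P i Pi with any? (λ i → P i Bool.≟ true)
... | yes _    = refl
... | no none = contradiction (i , Pi) none

exists-sound : ∀ {n} (P : Fin n → Bool) → exists P ≡ true → ∃ λ i → P i ≡ true
exists-sound P found with any? (λ i → P i Bool.≟ true)
... | yes witness = witness

∨-true : ∀ {a b} → a ∨ b ≡ true → a ≡ true ⊎ b ≡ true
∨-true {true}  _ = inj₁ refl
∨-true {false} b = inj₂ b

module NormalClosure (G : FiniteGroup) (x : Fin (FiniteGroup.order G)) where
  open GroupFacts G
  open ≡-Reasoning

  conjugate : Fin order → Fin order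
  conjugate b = b ∙ x ∙ b ⁻¹

  conjProduct : List (Fin order) → Fin order
  conjProduct []       = ε
  conjProduct (b ∷ bs) = conjugate b ∙ conjProduct bs

  conjugate-conjugate : ∀ g b → g ∙ conjugate b ∙ g ⁻¹ ≡ conjugate (g ∙ b)
  conjugate-conjugate g b = begin
    g ∙ (b ∙ x ∙ b ⁻¹) ∙ g ⁻¹       ≡⟨ assoc g _ _ ⟩
    g ∙ (b ∙ x ∙ b ⁻¹ ∙ g ⁻¹)       ≡⟨ cong (g ∙_) (assoc (b ∙ x) _ _) ⟩
    g ∙ (b ∙ x ∙ (b ⁻¹ ∙ g ⁻¹))     ≡⟨ cong (λ t → g ∙ (b ∙ x ∙ t)) (⁻¹-anti-homo-∙ g b) ⟨
    g ∙ (b ∙ x ∙ (g ∙ b) ⁻¹)        ≡⟨ assoc g _ _ ⟨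
    g ∙ (b ∙ x) ∙ (g ∙ b) ⁻¹        ≡⟨ cong (_∙ (g ∙ b) ⁻¹) (assoc g b x) ⟨
    g ∙ b ∙ x ∙ (g ∙ b) ⁻¹          ∎

  conjProduct-conjugate : ∀ g bs → g ∙ conjProduct bs ∙ g ⁻¹ ≡ conjProduct (map (g ∙_) bs)
  conjProduct-conjugate g []       = trans (cong (_∙ g ⁻¹) (identityʳ g)) (inverseʳ g)
  conjProduct-conjugate g (b ∷ bs) = begin
    g ∙ (c ∙ p) ∙ g ⁻¹                  ≡⟨ cong (_∙ g ⁻¹) (cong (g ∙_) (cong (_∙ p) (//-rightDividesˡ g c))) ⟨
    g ∙ ((c ∙ g ⁻¹) ∙ g ∙ p) ∙ g ⁻¹     ≡⟨ cong (_∙ g ⁻¹) (cong (g ∙_) (assoc (c ∙ g ⁻¹) g p)) ⟩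
    g ∙ ((c ∙ g ⁻¹) ∙ (g ∙ p)) ∙ g ⁻¹   ≡⟨ cong (_∙ g ⁻¹) (assoc g _ _) ⟨
    g ∙ (c ∙ g ⁻¹) ∙ (g ∙ p) ∙ g ⁻¹     ≡⟨ assoc _ _ _ ⟩
    g ∙ (c ∙ g ⁻¹) ∙ (g ∙ p ∙ g ⁻¹)     ≡⟨ cong₂ _∙_ (trans (sym (assoc g c _)) (conjugate-conjugate g b))
                                                     (conjProduct-conjugate g bs) ⟩
    conjProduct (map (g ∙_) (b ∷ bs))   ∎
    where
    c = conjugate b
    p = conjProduct bs

  AtMost : ℕ → Fin order → Bool
  AtMost zero    z = does (z Fin.≟ ε)
  AtMost (suc k) z = AtMost k z ∨ exists (λ b → AtMost k (z ∙ conjugate b ⁻¹))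

  AtMost-sound : ∀ k z → AtMost k z ≡ true → ∃ λ bs → conjProduct bs ≡ z
  AtMost-sound zero z z≟ε with z Fin.≟ ε
  ... | yes refl = [] , refl
  AtMost-sound (suc k) z found with ∨-true found
  ... | inj₁ shorter = AtMost-sound k z shorter
  ... | inj₂ longer with exists-sound _ longer
  ...   | b , prefix with AtMost-sound k _ prefix
  ...     | bs , bs≡z∙c⁻¹ = bs ++ [ b ] , (begin
    conjProduct (bs ++ [ b ])            ≡⟨ conjProduct-++ bs [ b ] ⟩
    conjProduct bs ∙ (conjugate b ∙ ε)   ≡⟨ cong₂ _∙_ bs≡z∙c⁻¹ (identityʳ _) ⟩
    z ∙ conjugate b ⁻¹ ∙ conjugate b     ≡⟨ //-rightDividesˡ (conjugate b) z ⟩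
    z                                    ∎)
    where
    conjProduct-++ : ∀ as bs → conjProduct (as ++ bs) ≡ conjProduct as ∙ conjProduct bs
    conjProduct-++ []       bs = sym (identityˡ _)
    conjProduct-++ (a ∷ as) bs = trans (cong (conjugate a ∙_) (conjProduct-++ as bs)) (sym (assoc _ _ _))

  private
    AtMost-mono : ∀ k → AtMost k ⊆ᵇ AtMost (suc k)
    AtMost-mono k z z∈ = cong (λ t → t ∨ exists (λ b → AtMost k (z ∙ conjugate b ⁻¹))) z∈

    stabilisation = chain-stabilises AtMost AtMost-mono

  K : ℕ
  K = proj₁ stabilisation

  closure : Fin order → Bool
  closure = AtMost K

  closure-sound : ∀ z → closure z ≡ true → ∃ λ bs → conjProduct bs ≡ z
  closure-sound = AtMost-sound K

  closure-ε : closure ε ≡ true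
  closure-ε = AtMost-ε K
    where
    AtMost-ε : ∀ k → AtMost k ε ≡ true
    AtMost-ε zero    with ε Fin.≟ ε
    ... | yes _   = refl
    ... | no ε≢ε = contradiction refl ε≢ε
    AtMost-ε (suc k) = cong (λ t → t ∨ exists (λ b → AtMost k (ε ∙ conjugate b ⁻¹))) (AtMost-ε k)

  closure-∙conjugate : ∀ a b → closure a ≡ true → closure (a ∙ conjugate b) ≡ true
  closure-∙conjugate a b ∈a = trans (sym (proj₂ stabilisation _))
    (trans (cong (AtMost K (a ∙ conjugate b) ∨_)
                 (exists-complete _ b (subst (λ t → closure t ≡ true) (sym (//-rightDividesʳ _ a)) ∈a)))
           (∨-zeroʳ _))

  closure-∙conjProduct : ∀ bs a → closure a ≡ true → closure (a ∙ conjProduct bs) ≡ true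
  closure-∙conjProduct []       a ∈a = subst (λ t → closure t ≡ true) (sym (identityʳ a)) ∈a
  closure-∙conjProduct (b ∷ bs) a ∈a = subst (λ t → closure t ≡ true) (assoc a _ _)
    (closure-∙conjProduct bs _ (closure-∙conjugate a b ∈a))

  closure-conjProduct : ∀ bs → closure (conjProduct bs) ≡ true
  closure-conjProduct bs = subst (λ t → closure t ≡ true) (identityˡ _) (closure-∙conjProduct bs ε closure-ε)

  closure-∙ : ∀ a c → closure a ≡ true → closure c ≡ true → closure (a ∙ c) ≡ true
  closure-∙ a c ∈a ∈c with closure-sound c ∈c
  ... | bs , refl = closure-∙conjProduct bs a ∈a

  closure-conj : ∀ g c → closure c ≡ true → closure (g ∙ c ∙ g ⁻¹) ≡ true
  closure-conj g c ∈c with closure-sound c ∈c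
  ... | bs , refl = subst (λ t → closure t ≡ true) (sym (conjProduct-conjugate g bs))
      (closure-conjProduct (map (g ∙_) bs))

  closure-normal : IsNormalSubgroup G closure
  closure-normal = closure-ε , closure-∙ , submonoid-⁻¹-closed G closure closure-ε closure-∙ , closure-conj

  products-of-conjugates : IsSimple G → x ≢ ε → ∀ z → ∃ λ bs → conjProduct bs ≡ z
  products-of-conjugates (_ , simple) x≢ε z with simple closure closure-normal
  ... | inj₂ everything = closure-sound z (everything z)
  ... | inj₁ trivial    = contradiction
      (trivial x (subst (λ t → closure t ≡ true) x-as-product (closure-conjProduct [ ε ]))) x≢ε
    where
    x-as-product : conjProduct [ ε ] ≡ x
    x-as-product = begin
      ε ∙ x ∙ ε ⁻¹ ∙ ε    ≡⟨ identityʳ _ ⟩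
      ε ∙ x ∙ ε ⁻¹        ≡⟨ cong₂ _∙_ (identityˡ x) ε⁻¹≈ε ⟩
      x ∙ ε               ≡⟨ identityʳ x ⟩
      x                   ∎

  conjugates-generate : IsSimple G → x ≢ ε → ∀ {n} (g : Fin n → Fin order) →
                        (∀ b → Gen G g (conjugate b)) → Generates G g
  conjugates-generate simple x≢ε g conjugates∈ z with products-of-conjugates simple x≢ε z
  ... | bs , refl = products∈ bs
    where
    products∈ : ∀ bs → Gen G g (conjProduct bs)
    products∈ []       = unit
    products∈ (b ∷ bs) = mul (conjugates∈ b) (products∈ bs)

-- Braid words on strands numbered by ℕ, and their permutations

iter-+ : ∀ {A : Set} (f : A → A) a b x → iter f (a + b) x ≡ iter f a (iter f b x)
iter-+ f zero    b x = refl
iter-+ f (suc a) b x = cong f (iter-+ f a b x)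

iter-cong : ∀ {A : Set} {f g : A → A} → (∀ x → f x ≡ g x) → ∀ k x → iter f k x ≡ iter g k x
iter-cong f≗g zero    x = refl
iter-cong {g = g} f≗g (suc k) x = trans (f≗g _) (cong g (iter-cong f≗g k x))

iter-suc : ∀ {A : Set} (f : A → A) k x → iter f (suc k) x ≡ iter f k (f x)
iter-suc f k x = trans (cong (λ t → iter f t x) (+-comm 1 k)) (iter-+ f k 1 x)

-- σ⁺ k and σ⁻ k stand for σ_{k+1} and its inverse.
data Letterℕ : Set where
  σ⁺ σ⁻ : ℕ → Letterℕ

Wordℕ : Set
Wordℕ = List Letterℕ

index : Letterℕ → ℕ
index (σ⁺ k) = k
index (σ⁻ k) = k

invert : Letterℕ → Letterℕ
invert (σ⁺ k) = σ⁻ k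
invert (σ⁻ k) = σ⁺ k

index-invert : ∀ l → index (invert l) ≡ index l
index-invert (σ⁺ k) = refl
index-invert (σ⁻ k) = refl

infix 10 _⁻¹ʷ
_⁻¹ʷ : Wordℕ → Wordℕ
[] ⁻¹ʷ      = []
(l ∷ w) ⁻¹ʷ = w ⁻¹ʷ ++ [ invert l ]

shift : ℕ → Letterℕ → Letterℕ
shift p (σ⁺ k) = σ⁺ (p + k)
shift p (σ⁻ k) = σ⁻ (p + k)

index-shift : ∀ p l → index (shift p l) ≡ p + index l
index-shift p (σ⁺ k) = refl
index-shift p (σ⁻ k) = refl

shiftʷ : ℕ → Wordℕ → Wordℕ
shiftʷ p = map (shift p)

repeatʷ : ℕ → Wordℕ → Wordℕ
repeatʷ zero    w = []
repeatʷ (suc k) w = repeatʷ k w ++ w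

transposition : ℕ → ℕ → ℕ
transposition zero    zero          = 1
transposition zero    (suc zero)    = 0
transposition zero    (suc (suc j)) = suc (suc j)
transposition (suc k) zero          = zero
transposition (suc k) (suc j)       = suc (transposition k j)

permℕ : Wordℕ → ℕ → ℕ
permℕ []      j = j
permℕ (l ∷ w) j = permℕ w (transposition (index l) j)

permℕ-++ : ∀ w₁ w₂ j → permℕ (w₁ ++ w₂) j ≡ permℕ w₂ (permℕ w₁ j)
permℕ-++ []       w₂ j = refl
permℕ-++ (l ∷ w₁) w₂ j = permℕ-++ w₁ w₂ _

permℕ-repeat : ∀ k w j → permℕ (repeatʷ k w) j ≡ iter (permℕ w) k j
permℕ-repeat zero    w j = refl
permℕ-repeat (suc k) w j = trans (permℕ-++ (repeatʷ k w) w j) (cong (permℕ w) (permℕ-repeat k w j))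

transposition-involutive : ∀ k j → transposition k (transposition k j) ≡ j
transposition-involutive zero    zero          = refl
transposition-involutive zero    (suc zero)    = refl
transposition-involutive zero    (suc (suc j)) = refl
transposition-involutive (suc k) zero          = refl
transposition-involutive (suc k) (suc j)       = cong suc (transposition-involutive k j)

permℕ-inverseˡ : ∀ w j → permℕ (w ⁻¹ʷ) (permℕ w j) ≡ j
permℕ-inverseˡ []      j = refl
permℕ-inverseˡ (l ∷ w) j = begin
  permℕ (w ⁻¹ʷ ++ [ invert l ]) (permℕ w t)
    ≡⟨ permℕ-++ (w ⁻¹ʷ) _ _ ⟩
  transposition (index (invert l)) (permℕ (w ⁻¹ʷ) (permℕ w t))
    ≡⟨ cong₂ transposition (index-invert l) (permℕ-inverseˡ w t) ⟩
  transposition (index l) t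
    ≡⟨ transposition-involutive (index l) j ⟩
  j ∎
  where
  open ≡-Reasoning
  t = transposition (index l) j

⁻¹ʷ-involutive : ∀ w → w ⁻¹ʷ ⁻¹ʷ ≡ w
⁻¹ʷ-involutive []      = refl
⁻¹ʷ-involutive (l ∷ w) = trans (⁻¹ʷ-++ (w ⁻¹ʷ) [ invert l ])
    (cong₂ _∷_ (invert-involutive l) (⁻¹ʷ-involutive w))
  where
  invert-involutive : ∀ l → invert (invert l) ≡ l
  invert-involutive (σ⁺ k) = refl
  invert-involutive (σ⁻ k) = refl
  ⁻¹ʷ-++ : ∀ w₁ w₂ → (w₁ ++ w₂) ⁻¹ʷ ≡ w₂ ⁻¹ʷ ++ w₁ ⁻¹ʷ
  ⁻¹ʷ-++ []       w₂ = sym (++-identityʳ _)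
  ⁻¹ʷ-++ (l ∷ w₁) w₂ = trans (cong (_++ [ invert l ]) (⁻¹ʷ-++ w₁ w₂)) (++-assoc (w₂ ⁻¹ʷ) (w₁ ⁻¹ʷ) _)

permℕ-inverseʳ : ∀ w j → permℕ w (permℕ (w ⁻¹ʷ) j) ≡ j
permℕ-inverseʳ w j = subst (λ v → permℕ v (permℕ (w ⁻¹ʷ) j) ≡ j) (⁻¹ʷ-involutive w) (permℕ-inverseˡ (w ⁻¹ʷ) j)

private
  transposition-shift : ∀ p k i → transposition (p + k) (p + i) ≡ p + transposition k i
  transposition-shift zero    k i = refl
  transposition-shift (suc p) k i = cong suc (transposition-shift p k i)

  transposition-< : ∀ p k i → i < p → transposition (p + k) i ≡ i
  transposition-< (suc p) k zero    _         = refl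
  transposition-< (suc p) k (suc i) (s≤s i<p) = cong suc (transposition-< p k i i<p)

permℕ-shift : ∀ p w i → permℕ (shiftʷ p w) (p + i) ≡ p + permℕ w i
permℕ-shift p []      i = refl
permℕ-shift p (l ∷ w) i = begin
  permℕ (shiftʷ p w) (transposition (index (shift p l)) (p + i))
    ≡⟨ cong (λ k → permℕ (shiftʷ p w) (transposition k (p + i))) (index-shift p l) ⟩
  permℕ (shiftʷ p w) (transposition (p + index l) (p + i))
    ≡⟨ cong (permℕ (shiftʷ p w)) (transposition-shift p (index l) i) ⟩
  permℕ (shiftʷ p w) (p + transposition (index l) i)
    ≡⟨ permℕ-shift p w _ ⟩
  p + permℕ w (transposition (index l) i) ∎
  where open ≡-Reasoning

permℕ-shift-< : ∀ p w i → i < p → permℕ (shiftʷ p w) i ≡ i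
permℕ-shift-< p []      i i<p = refl
permℕ-shift-< p (l ∷ w) i i<p = begin
  permℕ (shiftʷ p w) (transposition (index (shift p l)) i)
    ≡⟨ cong (λ k → permℕ (shiftʷ p w) (transposition k i)) (index-shift p l) ⟩
  permℕ (shiftʷ p w) (transposition (p + index l) i)
    ≡⟨ cong (permℕ (shiftʷ p w)) (transposition-< p (index l) i i<p) ⟩
  permℕ (shiftʷ p w) i
    ≡⟨ permℕ-shift-< p w i i<p ⟩
  i ∎
  where open ≡-Reasoning

passRight : ℕ → Wordℕ
passRight zero    = []
passRight (suc l) = σ⁺ 0 ∷ shiftʷ 1 (passRight l)

passRight-zero : ∀ l → permℕ (passRight l) 0 ≡ l
passRight-zero zero    = refl
passRight-zero (suc l) = trans (permℕ-shift 1 (passRight l) 0) (cong suc (passRight-zero l))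

passRight-suc : ∀ l i → i < l → permℕ (passRight l) (suc i) ≡ i
passRight-suc (suc l) zero    _         = permℕ-shift-< 1 (passRight l) 0 (s≤s z≤n)
passRight-suc (suc l) (suc i) (s≤s i<l) = trans (permℕ-shift 1 (passRight l) (suc i))
    (cong suc (passRight-suc l i i<l))

passRight-> : ∀ l i → l < i → permℕ (passRight l) i ≡ i
passRight-> zero    i               _         = refl
passRight-> (suc l) (suc (suc i)) (s≤s l<i) = trans (permℕ-shift 1 (passRight l) (suc i))
    (cong suc (passRight-> l (suc i) l<i))

module Rotation (l : ℕ) where
  private
    ρ : ℕ → ℕ
    ρ = permℕ (passRight l)

  rotate-down : ∀ k d → k + d ≤ l → iter ρ k (k + d) ≡ d
  rotate-down zero    d _ = refl
  rotate-down (suc k) d k+d<l = begin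
    ρ (iter ρ k (suc (k + d)))   ≡⟨ cong (ρ ∘ iter ρ k) (+-suc k d) ⟨
    ρ (iter ρ k (k + suc d))     ≡⟨ cong ρ (rotate-down k (suc d) (subst (_≤ l) (sym (+-suc k d)) k+d<l)) ⟩
    ρ (suc d)                    ≡⟨ passRight-suc l d (≤-trans (s≤s (m≤n+m d k)) k+d<l) ⟩
    d                            ∎
    where open ≡-Reasoning

  rotate-wrap : ∀ k d m → d < k → m + k ≡ suc l → iter ρ k d ≡ m + d
  rotate-wrap (suc k) d m (s≤s d≤k) m+k≡l with m≤n⇒m<n∨m≡n d≤k
  ... | inj₁ d<k = begin
    ρ (iter ρ k d)        ≡⟨ cong ρ (rotate-wrap k d (suc m) d<k (trans (sym (+-suc m k)) m+k≡l)) ⟩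
    ρ (suc (m + d))       ≡⟨ passRight-suc l (m + d) (subst (m + d <_) m+k≡l′ (+-monoʳ-< m d<k)) ⟩
    m + d                 ∎
    where
    open ≡-Reasoning
    m+k≡l′ : m + k ≡ l
    m+k≡l′ = suc-injective (trans (sym (+-suc m k)) m+k≡l)
  ... | inj₂ refl = begin
    ρ (iter ρ d d)        ≡⟨ cong (ρ ∘ iter ρ d) (+-identityʳ d) ⟨
    ρ (iter ρ d (d + 0))  ≡⟨ cong ρ (rotate-down d 0 (subst (_≤ l) (sym (+-identityʳ d)) d≤l)) ⟩
    ρ 0                   ≡⟨ passRight-zero l ⟩
    l                     ≡⟨ suc-injective (trans (sym (+-suc m d)) m+k≡l) ⟨
    m + d                 ∎
    where
    open ≡-Reasoning
    d≤l : d ≤ l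
    d≤l = subst (d ≤_) (suc-injective (trans (sym (+-suc m d)) m+k≡l)) (m≤n+m d m)

  rotate-beyond : ∀ k i → l < i → iter ρ k i ≡ i
  rotate-beyond zero    i _   = refl
  rotate-beyond (suc k) i l<i = trans (cong ρ (rotate-beyond k i l<i)) (passRight-> l i l<i)

  rotate-full : ∀ i → iter ρ (suc l) i ≡ i
  rotate-full i with i ≤? l
  ... | yes i≤l = rotate-wrap (suc l) i 0 (s≤s i≤l) refl
  ... | no  i≰l = rotate-beyond (suc l) i (≰⇒> i≰l)

Bounded : ℕ → Wordℕ → Set
Bounded B = All (λ l → suc (index l) < B)

Bounded-mono : ∀ {B B′} → B ≤ B′ → ∀ {w} → Bounded B w → Bounded B′ w
Bounded-mono B≤B′ = All.map (λ l< → ≤-trans l< B≤B′)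

Bounded-shift : ∀ {B} p {w} → Bounded B w → Bounded (p + B) (shiftʷ p w)
Bounded-shift {B} p bounded = map⁺ (All.map (λ {l} → shifted {l}) bounded)
  where
  shifted : ∀ {l} → suc (index l) < B → suc (index (shift p l)) < p + B
  shifted {l} l< = subst (λ k → suc k < p + B) (sym (index-shift p l))
                         (subst (_< p + B) (+-suc p (index l)) (+-monoʳ-< p l<))

Bounded-⁻¹ʷ : ∀ {B w} → Bounded B w → Bounded B (w ⁻¹ʷ)
Bounded-⁻¹ʷ {w = []}    []          = []
Bounded-⁻¹ʷ {w = l ∷ w} (l< ∷ w<) =
  ++⁺ (Bounded-⁻¹ʷ w<) (subst (λ k → suc k < _) (sym (index-invert l)) l< ∷ [])

Bounded-repeat : ∀ {B} k {w} → Bounded B w → Bounded B (repeatʷ k w)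
Bounded-repeat zero    bounded = []
Bounded-repeat (suc k) bounded = ++⁺ (Bounded-repeat k bounded) bounded

Bounded-passRight : ∀ l → Bounded (suc l) (passRight l)
Bounded-passRight zero    = []
Bounded-passRight (suc l) = s≤s (s≤s z≤n) ∷ Bounded-shift 1 (Bounded-passRight l)

module BlockWords (L′ : ℕ) where
  open ≡-Reasoning

  L : ℕ
  L = suc L′

  blockSwapʷ : Wordℕ
  blockSwapʷ = repeatʷ L (passRight (L′ + L))

  twistʷ : Wordℕ
  twistʷ = repeatʷ (suc L) (passRight L)

  moveRootʷ : ℕ → Wordℕ
  moveRootʷ zero    = []
  moveRootʷ (suc k) = blockSwapʷ ++ shiftʷ L (moveRootʷ k)

  swapRootʷ : ℕ → Wordℕ
  swapRootʷ r = moveRootʷ (suc r) ++ moveRootʷ r ⁻¹ʷ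

  conjugateRootʷ : ℕ → Wordℕ
  conjugateRootʷ q = shiftʷ L (moveRootʷ q ⁻¹ʷ) ++ twistʷ ++ shiftʷ L (moveRootʷ q)

  conjugateRootByʷ : List ℕ → Wordℕ
  conjugateRootByʷ []       = []
  conjugateRootByʷ (q ∷ qs) = conjugateRootʷ q ++ conjugateRootByʷ qs

  joinʷ : List ℕ → ℕ → Wordℕ
  joinʷ qs r = conjugateRootByʷ qs ++ swapRootʷ r ++ conjugateRootByʷ qs ⁻¹ʷ

  private
    offset : ∀ {p} → L ≤ p → ∃ λ p′ → L + p′ ≡ p
    offset L≤p = m≤n⇒∃[o]m+o≡n L≤p

    permℕ-fixed-inverse : ∀ w {j} → permℕ w j ≡ j → permℕ (w ⁻¹ʷ) j ≡ j
    permℕ-fixed-inverse w {j} fixed = trans (cong (permℕ (w ⁻¹ʷ)) (sym fixed)) (permℕ-inverseˡ w j)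

    permℕ-inverse-≡ : ∀ w {i j} → permℕ w i ≡ j → permℕ (w ⁻¹ʷ) j ≡ i
    permℕ-inverse-≡ w {i} refl = permℕ-inverseˡ w i

  blockSwap-root : ∀ o → o < L → permℕ blockSwapʷ o ≡ L + o
  blockSwap-root o o<L = trans (permℕ-repeat L _ o) (Rotation.rotate-wrap (L′ + L) L o L o<L refl)

  blockSwap-next : ∀ o → o < L → permℕ blockSwapʷ (L + o) ≡ o
  blockSwap-next o (s≤s o≤L′) = trans (permℕ-repeat L _ (L + o))
    (Rotation.rotate-down (L′ + L) L o (subst (L + o ≤_) (+-comm L L′) (+-monoʳ-≤ L o≤L′)))

  blockSwap-beyond : ∀ p → L + L ≤ p → permℕ blockSwapʷ p ≡ p
  blockSwap-beyond p 2L≤p = trans (permℕ-repeat L _ p) (Rotation.rotate-beyond (L′ + L) L p 2L≤p)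

  twist-perm : ∀ p → permℕ twistʷ p ≡ p
  twist-perm p = trans (permℕ-repeat (suc L) _ p) (Rotation.rotate-full L p)

  moveRoot-root : ∀ k o → o < L → permℕ (moveRootʷ k) o ≡ k * L + o
  moveRoot-root zero    o o<L = refl
  moveRoot-root (suc k) o o<L = begin
    permℕ (moveRootʷ (suc k)) o
      ≡⟨ permℕ-++ blockSwapʷ _ o ⟩
    permℕ (shiftʷ L (moveRootʷ k)) (permℕ blockSwapʷ o)
      ≡⟨ cong (permℕ (shiftʷ L (moveRootʷ k))) (blockSwap-root o o<L) ⟩
    permℕ (shiftʷ L (moveRootʷ k)) (L + o)
      ≡⟨ permℕ-shift L (moveRootʷ k) o ⟩
    L + permℕ (moveRootʷ k) o
      ≡⟨ cong (L +_) (moveRoot-root k o o<L) ⟩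
    L + (k * L + o)
      ≡⟨ +-assoc L (k * L) o ⟨
    suc k * L + o ∎

  moveRoot-next : ∀ k p → L ≤ p → p < suc k * L → permℕ (moveRootʷ k) p ≡ p ∸ L
  moveRoot-next zero    p L≤p p<L = contradiction (≤-<-trans L≤p (subst (p <_) (+-identityʳ L) p<L))
      (<-irrefl refl)
  moveRoot-next (suc k) p L≤p p<  with offset L≤p
  ... | p′ , refl with p′ <? L
  ...   | yes p′<L = begin
    permℕ (moveRootʷ (suc k)) (L + p′)
      ≡⟨ permℕ-++ blockSwapʷ _ _ ⟩
    permℕ (shiftʷ L (moveRootʷ k)) (permℕ blockSwapʷ (L + p′))
      ≡⟨ cong (permℕ (shiftʷ L (moveRootʷ k))) (blockSwap-next p′ p′<L) ⟩
    permℕ (shiftʷ L (moveRootʷ k)) p′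
      ≡⟨ permℕ-shift-< L (moveRootʷ k) p′ p′<L ⟩
    p′
      ≡⟨ m+n∸m≡n L p′ ⟨
    L + p′ ∸ L ∎
  ...   | no p′≮L = begin
    permℕ (moveRootʷ (suc k)) (L + p′)
      ≡⟨ permℕ-++ blockSwapʷ _ _ ⟩
    permℕ (shiftʷ L (moveRootʷ k)) (permℕ blockSwapʷ (L + p′))
      ≡⟨ cong (permℕ (shiftʷ L (moveRootʷ k))) (blockSwap-beyond (L + p′) (+-monoʳ-≤ L (≮⇒≥ p′≮L))) ⟩
    permℕ (shiftʷ L (moveRootʷ k)) (L + p′)
      ≡⟨ permℕ-shift L (moveRootʷ k) p′ ⟩
    L + permℕ (moveRootʷ k) p′
      ≡⟨ cong (L +_) (moveRoot-next k p′ (≮⇒≥ p′≮L) (+-cancelˡ-< L p′ _ p<)) ⟩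
    L + (p′ ∸ L)
      ≡⟨ m+[n∸m]≡n (≮⇒≥ p′≮L) ⟩
    p′
      ≡⟨ m+n∸m≡n L p′ ⟨
    L + p′ ∸ L ∎

  moveRoot-beyond : ∀ k p → suc k * L ≤ p → permℕ (moveRootʷ k) p ≡ p
  moveRoot-beyond zero    p _ = refl
  moveRoot-beyond (suc k) p k+2L≤p with offset (≤-trans (m≤m+n L _) k+2L≤p)
  ... | p′ , refl = begin
    permℕ (moveRootʷ (suc k)) (L + p′)
      ≡⟨ permℕ-++ blockSwapʷ _ _ ⟩
    permℕ (shiftʷ L (moveRootʷ k)) (permℕ blockSwapʷ (L + p′))
      ≡⟨ cong (permℕ (shiftʷ L (moveRootʷ k))) (blockSwap-beyond (L + p′) (+-monoʳ-≤ L L≤p′)) ⟩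
    permℕ (shiftʷ L (moveRootʷ k)) (L + p′)
      ≡⟨ permℕ-shift L (moveRootʷ k) p′ ⟩
    L + permℕ (moveRootʷ k) p′
      ≡⟨ cong (L +_) (moveRoot-beyond k p′ k+L≤p′) ⟩
    L + p′ ∎
    where
    k+L≤p′ : suc k * L ≤ p′
    k+L≤p′ = +-cancelˡ-≤ L _ _ k+2L≤p
    L≤p′ : L ≤ p′
    L≤p′ = ≤-trans (m≤m+n L _) k+L≤p′

  swapRoot-root : ∀ r o → o < L → permℕ (swapRootʷ r) o ≡ suc r * L + o
  swapRoot-root r o o<L = begin
    permℕ (swapRootʷ r) o
      ≡⟨ permℕ-++ (moveRootʷ (suc r)) _ o ⟩
    permℕ (moveRootʷ r ⁻¹ʷ) (permℕ (moveRootʷ (suc r)) o)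
      ≡⟨ cong (permℕ (moveRootʷ r ⁻¹ʷ)) (moveRoot-root (suc r) o o<L) ⟩
    permℕ (moveRootʷ r ⁻¹ʷ) (suc r * L + o)
      ≡⟨ permℕ-fixed-inverse (moveRootʷ r) (moveRoot-beyond r _ (m≤m+n _ o)) ⟩
    suc r * L + o ∎

  swapRoot-target : ∀ r o → o < L → permℕ (swapRootʷ r) (suc r * L + o) ≡ o
  swapRoot-target r o o<L = begin
    permℕ (swapRootʷ r) (suc r * L + o)
      ≡⟨ permℕ-++ (moveRootʷ (suc r)) _ _ ⟩
    permℕ (moveRootʷ r ⁻¹ʷ) (permℕ (moveRootʷ (suc r)) (suc r * L + o))
      ≡⟨ cong (permℕ (moveRootʷ r ⁻¹ʷ)) (moveRoot-next (suc r) _ L≤ <next) ⟩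
    permℕ (moveRootʷ r ⁻¹ʷ) (suc r * L + o ∸ L)
      ≡⟨ cong (permℕ (moveRootʷ r ⁻¹ʷ)) drop-block ⟩
    permℕ (moveRootʷ r ⁻¹ʷ) (r * L + o)
      ≡⟨ permℕ-inverse-≡ (moveRootʷ r) (moveRoot-root r o o<L) ⟩
    o ∎
    where
    drop-block : suc r * L + o ∸ L ≡ r * L + o
    drop-block = trans (cong (_∸ L) (+-assoc L (r * L) o)) (m+n∸m≡n L _)
    L≤ : L ≤ suc r * L + o
    L≤ = ≤-trans (m≤m+n L (r * L)) (m≤m+n _ o)
    <next : suc r * L + o < suc (suc r) * L
    <next = subst (suc r * L + o <_) (+-comm (suc r * L) L) (+-monoʳ-< (suc r * L) o<L)

  swapRoot-between : ∀ r p → L ≤ p → p < suc r * L → permℕ (swapRootʷ r) p ≡ p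
  swapRoot-between r p L≤p p< = begin
    permℕ (swapRootʷ r) p
      ≡⟨ permℕ-++ (moveRootʷ (suc r)) _ p ⟩
    permℕ (moveRootʷ r ⁻¹ʷ) (permℕ (moveRootʷ (suc r)) p)
      ≡⟨ cong (permℕ (moveRootʷ r ⁻¹ʷ)) (moveRoot-next (suc r) p L≤p (<-≤-trans p< (m≤n+m _ L))) ⟩
    permℕ (moveRootʷ r ⁻¹ʷ) (p ∸ L)
      ≡⟨ permℕ-inverse-≡ (moveRootʷ r) (moveRoot-next r p L≤p p<) ⟩
    p ∎

  swapRoot-beyond : ∀ r p → suc (suc r) * L ≤ p → permℕ (swapRootʷ r) p ≡ p
  swapRoot-beyond r p r+2≤p = begin
    permℕ (swapRootʷ r) p
      ≡⟨ permℕ-++ (moveRootʷ (suc r)) _ p ⟩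
    permℕ (moveRootʷ r ⁻¹ʷ) (permℕ (moveRootʷ (suc r)) p)
      ≡⟨ cong (permℕ (moveRootʷ r ⁻¹ʷ)) (moveRoot-beyond (suc r) p r+2≤p) ⟩
    permℕ (moveRootʷ r ⁻¹ʷ) p
      ≡⟨ permℕ-fixed-inverse (moveRootʷ r) (moveRoot-beyond r p (≤-trans (m≤n+m _ L) r+2≤p)) ⟩
    p ∎

  conjugateRoot-perm : ∀ q p → permℕ (conjugateRootʷ q) p ≡ p
  conjugateRoot-perm q p = begin
    permℕ (shiftʷ L (M ⁻¹ʷ) ++ twistʷ ++ shiftʷ L M) p
      ≡⟨ permℕ-++ (shiftʷ L (M ⁻¹ʷ)) _ p ⟩
    permℕ (twistʷ ++ shiftʷ L M) (permℕ (shiftʷ L (M ⁻¹ʷ)) p)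
      ≡⟨ permℕ-++ twistʷ _ _ ⟩
    permℕ (shiftʷ L M) (permℕ twistʷ (permℕ (shiftʷ L (M ⁻¹ʷ)) p))
      ≡⟨ cong (permℕ (shiftʷ L M)) (twist-perm _) ⟩
    permℕ (shiftʷ L M) (permℕ (shiftʷ L (M ⁻¹ʷ)) p)
      ≡⟨ shifted-cancel (p <? L) ⟩
    p ∎
    where
    M = moveRootʷ q
    shifted-cancel : Dec (p < L) → permℕ (shiftʷ L M) (permℕ (shiftʷ L (M ⁻¹ʷ)) p) ≡ p
    shifted-cancel (yes p<L) = trans (cong (permℕ (shiftʷ L M)) (permℕ-shift-< L (M ⁻¹ʷ) p p<L))
        (permℕ-shift-< L M p p<L)
    shifted-cancel (no p≮L) with offset (≮⇒≥ p≮L)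
    ... | p′ , refl = begin
      permℕ (shiftʷ L M) (permℕ (shiftʷ L (M ⁻¹ʷ)) (L + p′))
        ≡⟨ cong (permℕ (shiftʷ L M)) (permℕ-shift L (M ⁻¹ʷ) p′) ⟩
      permℕ (shiftʷ L M) (L + permℕ (M ⁻¹ʷ) p′)
        ≡⟨ permℕ-shift L M _ ⟩
      L + permℕ M (permℕ (M ⁻¹ʷ) p′)
        ≡⟨ cong (L +_) (permℕ-inverseʳ M p′) ⟩
      L + p′ ∎

  conjugateRootBy-perm : ∀ qs p → permℕ (conjugateRootByʷ qs) p ≡ p
  conjugateRootBy-perm []       p = refl
  conjugateRootBy-perm (q ∷ qs) p = trans (permℕ-++ (conjugateRootʷ q) _ p)
    (trans (cong (permℕ (conjugateRootByʷ qs)) (conjugateRoot-perm q p)) (conjugateRootBy-perm qs p))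

  join-perm : ∀ qs r p → permℕ (joinʷ qs r) p ≡ permℕ (swapRootʷ r) p
  join-perm qs r p = begin
    permℕ (C ++ swapRootʷ r ++ C ⁻¹ʷ) p
      ≡⟨ permℕ-++ C _ p ⟩
    permℕ (swapRootʷ r ++ C ⁻¹ʷ) (permℕ C p)
      ≡⟨ cong (permℕ (swapRootʷ r ++ C ⁻¹ʷ)) (conjugateRootBy-perm qs p) ⟩
    permℕ (swapRootʷ r ++ C ⁻¹ʷ) p
      ≡⟨ permℕ-++ (swapRootʷ r) _ p ⟩
    permℕ (C ⁻¹ʷ) (permℕ (swapRootʷ r) p)
      ≡⟨ permℕ-fixed-inverse C (conjugateRootBy-perm qs _) ⟩
    permℕ (swapRootʷ r) p ∎
    where C = conjugateRootByʷ qs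

  Bounded-blockSwap : Bounded (L + L) blockSwapʷ
  Bounded-blockSwap = Bounded-repeat L (Bounded-passRight (L′ + L))

  Bounded-twist : Bounded (L + L) twistʷ
  Bounded-twist = Bounded-mono (s≤s (m≤n+m L L′)) (Bounded-repeat (suc L) (Bounded-passRight L))

  Bounded-moveRoot : ∀ k → Bounded (suc k * L) (moveRootʷ k)
  Bounded-moveRoot zero    = []
  Bounded-moveRoot (suc k) = ++⁺ (Bounded-mono (+-monoʳ-≤ L (m≤m+n L (k * L))) Bounded-blockSwap)
                                 (Bounded-shift L (Bounded-moveRoot k))

  Bounded-swapRoot : ∀ r → Bounded (suc (suc r) * L) (swapRootʷ r)
  Bounded-swapRoot r = ++⁺ (Bounded-moveRoot (suc r))
      (Bounded-mono (m≤n+m _ L) (Bounded-⁻¹ʷ (Bounded-moveRoot r)))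

  Bounded-conjugateRoot : ∀ q → Bounded (suc (suc q) * L) (conjugateRootʷ q)
  Bounded-conjugateRoot q = ++⁺ (Bounded-shift L (Bounded-⁻¹ʷ (Bounded-moveRoot q)))
                                (++⁺ (Bounded-mono (+-monoʳ-≤ L (m≤m+n L (q * L))) Bounded-twist)
                                     (Bounded-shift L (Bounded-moveRoot q)))

  Bounded-join : ∀ m qs r → All (_< m) qs → r < m → Bounded (suc m * L) (joinʷ qs r)
  Bounded-join m qs r qs<m r<m = ++⁺ (conjugations qs<m)
      (++⁺ (Bounded-mono (*-monoˡ-≤ L (s≤s r<m)) (Bounded-swapRoot r)) (Bounded-⁻¹ʷ (conjugations qs<m)))
    where
    conjugations : ∀ {qs} → All (_< m) qs → Bounded (suc m * L) (conjugateRootByʷ qs)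
    conjugations []                   = []
    conjugations {q ∷ _} (q<m ∷ qs<m) = ++⁺ (Bounded-mono (*-monoˡ-≤ L (s≤s q<m)) (Bounded-conjugateRoot q))
        (conjugations qs<m)

-- Cyclic permutations

Reaches : (ℕ → ℕ) → ℕ → ℕ → Set
Reaches π p q = ∃ λ k → iter π k p ≡ q

reaches-refl : ∀ {π p} → Reaches π p p
reaches-refl = 0 , refl

reaches-step : ∀ {π p} → Reaches π p (π p)
reaches-step = 1 , refl

reaches-trans : ∀ {π p q r} → Reaches π p q → Reaches π q r → Reaches π p r
reaches-trans {π} {p} (k , refl) (k′ , refl) = k′ + k , iter-+ π k′ k p

record IsCycleOn (π : ℕ → ℕ) (B : ℕ) : Set where
  field
    fixes-beyond : ∀ p → B ≤ p → π p ≡ p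
    maps-into    : ∀ p → p < B → π p < B
    transitive   : ∀ p q → p < B → q < B → Reaches π p q

IsCycleOn-cong : ∀ {π π′ B} → (∀ p → π p ≡ π′ p) → IsCycleOn π B → IsCycleOn π′ B
IsCycleOn-cong {π} {π′} π≗π′ cycle = record
  { fixes-beyond = λ p B≤p → trans (sym (π≗π′ p)) (fixes-beyond p B≤p)
  ; maps-into    = λ p p<B → subst (_< _) (π≗π′ p) (maps-into p p<B)
  ; transitive   = λ p q p<B q<B → let (k , eq) = transitive p q p<B q<B
                                     in k , trans (sym (iter-cong π≗π′ k p)) eq
  }
  where open IsCycleOn cycle

passRight-cycle : ∀ l → IsCycleOn (permℕ (passRight l)) (suc l)
passRight-cycle l = record
  { fixes-beyond = λ p l<p → passRight-> l p l<p
  ; maps-into    = maps-into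
  ; transitive   = λ p q p≤l q≤l → reaches-trans (down-to-0 p p≤l)
      (reaches-trans reaches-step (down-from-l q q≤l))
  }
  where
  ρ = permℕ (passRight l)
  open Rotation l
  maps-into : ∀ p → p < suc l → ρ p < suc l
  maps-into zero    _         = subst (_< suc l) (sym (passRight-zero l)) ≤-refl
  maps-into (suc p) (s≤s p<l) = subst (_< suc l) (sym (passRight-suc l p p<l)) (m≤n⇒m≤1+n p<l)
  down-to-0 : ∀ p → p < suc l → Reaches ρ p 0
  down-to-0 p (s≤s p≤l) = p , trans (cong (iter ρ p) (sym (+-identityʳ p)))
      (rotate-down p 0 (subst (_≤ l) (sym (+-identityʳ p)) p≤l))
  down-from-l : ∀ q → q < suc l → Reaches ρ (ρ 0) q
  down-from-l q (s≤s q≤l) = l ∸ q , (begin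
    iter ρ (l ∸ q) (ρ 0)          ≡⟨ cong (iter ρ (l ∸ q)) (passRight-zero l) ⟩
    iter ρ (l ∸ q) l              ≡⟨ cong (iter ρ (l ∸ q)) (m∸n+n≡m q≤l) ⟨
    iter ρ (l ∸ q) (l ∸ q + q)    ≡⟨ rotate-down (l ∸ q) q (≤-reflexive (m∸n+n≡m q≤l)) ⟩
    q                             ∎)
    where open ≡-Reasoning

module _ {π S : ℕ → ℕ} {B L : ℕ} (L≤B : L ≤ B) (cycle : IsCycleOn π B)
         (S-root    : ∀ o → o < L → S o ≡ B + o)
         (S-target  : ∀ o → o < L → S (B + o) ≡ o)
         (S-between : ∀ p → L ≤ p → p < B → S p ≡ p)
         (S-beyond  : ∀ p → B + L ≤ p → S p ≡ p) where

  open IsCycleOn cycle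

  private
    π′ : ℕ → ℕ
    π′ = S ∘ π

    iter-< : ∀ k {p} → p < B → iter π k p < B
    iter-< zero    p<B = p<B
    iter-< (suc k) p<B = maps-into _ (iter-< k p<B)

    π-step : ∀ y → y < B → Reaches π′ y (π y)
    π-step y y<B with π y <? L
    ... | yes πy<L = 2 , (begin
      S (π (S (π y)))     ≡⟨ cong (S ∘ π) (S-root (π y) πy<L) ⟩
      S (π (B + π y))     ≡⟨ cong S (fixes-beyond _ (m≤m+n B _)) ⟩
      S (B + π y)         ≡⟨ S-target (π y) πy<L ⟩
      π y                 ∎)
      where open ≡-Reasoning
    ... | no πy≮L = 1 , S-between (π y) (≮⇒≥ πy≮L) (maps-into y y<B)

    simulate : ∀ k {p} → p < B → Reaches π′ p (iter π k p)
    simulate zero    p<B = reaches-refl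
    simulate (suc k) p<B = reaches-trans (simulate k p<B) (π-step _ (iter-< k p<B))

    inside : ∀ p q → p < B → q < B → Reaches π′ p q
    inside p q p<B q<B with transitive p q p<B q<B
    ... | k , refl = simulate k p<B

    into-block : ∀ p o → p < B → o < L → Reaches π′ p (B + o)
    into-block p o p<B o<L with transitive (π o) o (maps-into o o<B) o<B
      where o<B = <-≤-trans o<L L≤B
    ... | k , πᵏπo≡o = reaches-trans (inside p y p<B (iter-< k (<-≤-trans o<L L≤B)))
                                      (1 , trans (cong S (trans (iter-suc π k o) πᵏπo≡o)) (S-root o o<L))
      where y = iter π k o

    leave-block : ∀ o → o < L → π′ (B + o) ≡ o
    leave-block o o<L = trans (cong S (fixes-beyond (B + o) (m≤m+n B o))) (S-target o o<L)

    offset : ∀ p → B ≤ p → p < B + L → ∃ λ o → o < L × B + o ≡ p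
    offset p B≤p p< = p ∸ B , +-cancelˡ-< B (p ∸ B) L (subst (_< B + L) (sym (m+[n∸m]≡n B≤p)) p<)
                          , m+[n∸m]≡n B≤p

  cycle-merge : IsCycleOn π′ (B + L)
  cycle-merge = record
    { fixes-beyond = λ p B+L≤p → trans (cong S (fixes-beyond p (≤-trans (m≤m+n B L) B+L≤p))) (S-beyond p B+L≤p)
    ; maps-into    = maps-into′
    ; transitive   = transitive′
    }
    where
    maps-into′ : ∀ p → p < B + L → π′ p < B + L
    maps-into′ p p< with p <? B
    ... | no p≮B with offset p (≮⇒≥ p≮B) p<
    ...   | o , o<L , refl = subst (_< B + L) (sym (leave-block o o<L)) (<-≤-trans o<L (m≤n+m L B))
    maps-into′ p p< | yes p<B with π p <? L
    ...   | yes πp<L = subst (_< B + L) (sym (S-root (π p) πp<L)) (+-monoʳ-< B πp<L)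
    ...   | no πp≮L  = subst (_< B + L) (sym (S-between (π p) (≮⇒≥ πp≮L) (maps-into p p<B)))
                             (<-≤-trans (maps-into p p<B) (m≤m+n B L))
    enter : ∀ p → p < B + L → ∃ λ p₀ → p₀ < B × Reaches π′ p p₀
    enter p p< with p <? B
    ... | yes p<B = p , p<B , reaches-refl
    ... | no p≮B with offset p (≮⇒≥ p≮B) p<
    ...   | o , o<L , refl = o , <-≤-trans o<L L≤B , 1 , leave-block o o<L
    transitive′ : ∀ p q → p < B + L → q < B + L → Reaches π′ p q
    transitive′ p q p< q< with enter p p< | q <? B
    ... | p₀ , p₀<B , p↝p₀ | yes q<B = reaches-trans p↝p₀ (inside p₀ q p₀<B q<B)
    ... | p₀ , p₀<B , p↝p₀ | no q≮B with offset q (≮⇒≥ q≮B) q<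
    ...   | o , o<L , refl = reaches-trans p↝p₀ (into-block p₀ o p₀<B o<L)

-- The braid action on lists of group elements

module ListAction (G : FiniteGroup) where
  open GroupFacts G
  open ≡-Reasoning

  ∏ : List Carrier → Carrier
  ∏ []       = ε
  ∏ (u ∷ us) = u ∙ ∏ us

  ∏-++ : ∀ us vs → ∏ (us ++ vs) ≡ ∏ us ∙ ∏ vs
  ∏-++ []       vs = sym (identityˡ _)
  ∏-++ (u ∷ us) vs = trans (cong (u ∙_) (∏-++ us vs)) (sym (assoc u _ _))

  ∏-replicate : ∀ k a → ∏ (replicate k a) ≡ a ^ k
  ∏-replicate zero    a = refl
  ∏-replicate (suc k) a = cong (a ∙_) (∏-replicate k a)

  atDepth : ℕ → (List Carrier → List Carrier) → List Carrier → List Carrier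
  atDepth zero    f us       = f us
  atDepth (suc k) f []       = []
  atDepth (suc k) f (u ∷ us) = u ∷ atDepth k f us

  σ⁺₀ σ⁻₀ : List Carrier → List Carrier
  σ⁺₀ (u ∷ v ∷ us) = v ∷ u ^ᶜ v ∷ us
  σ⁺₀ us           = us
  σ⁻₀ (u ∷ v ∷ us) = u ∙ v ∙ u ⁻¹ ∷ u ∷ us
  σ⁻₀ us           = us

  actLetterᴸ : Letterℕ → List Carrier → List Carrier
  actLetterᴸ (σ⁺ k) = atDepth k σ⁺₀
  actLetterᴸ (σ⁻ k) = atDepth k σ⁻₀

  actᴸ : Wordℕ → List Carrier → List Carrier
  actᴸ []      us = us
  actᴸ (l ∷ w) us = actᴸ w (actLetterᴸ l us)

  actᴸ-++ : ∀ w₁ w₂ us → actᴸ (w₁ ++ w₂) us ≡ actᴸ w₂ (actᴸ w₁ us)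
  actᴸ-++ []       w₂ us = refl
  actᴸ-++ (l ∷ w₁) w₂ us = actᴸ-++ w₁ w₂ _

  actᴸ-repeat : ∀ k w us → actᴸ (repeatʷ k w) us ≡ iter (actᴸ w) k us
  actᴸ-repeat zero    w us = refl
  actᴸ-repeat (suc k) w us = trans (actᴸ-++ (repeatʷ k w) w us) (cong (actᴸ w) (actᴸ-repeat k w us))

  length-actᴸ : ∀ w us → length (actᴸ w us) ≡ length us
  length-actᴸ []      us = refl
  length-actᴸ (l ∷ w) us = trans (length-actᴸ w _) (length-actLetter l us)
    where
    length-σ⁺₀ : ∀ us → length (σ⁺₀ us) ≡ length us
    length-σ⁺₀ (u ∷ v ∷ us) = refl
    length-σ⁺₀ []           = refl
    length-σ⁺₀ (u ∷ [])     = refl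
    length-σ⁻₀ : ∀ us → length (σ⁻₀ us) ≡ length us
    length-σ⁻₀ (u ∷ v ∷ us) = refl
    length-σ⁻₀ []           = refl
    length-σ⁻₀ (u ∷ [])     = refl
    length-atDepth : ∀ {f} → (∀ us → length (f us) ≡ length us) → ∀ k us → length (atDepth k f us) ≡ length us
    length-atDepth f-len zero    us       = f-len us
    length-atDepth f-len (suc k) []       = refl
    length-atDepth f-len (suc k) (u ∷ us) = cong suc (length-atDepth f-len k us)
    length-actLetter : ∀ l us → length (actLetterᴸ l us) ≡ length us
    length-actLetter (σ⁺ k) = length-atDepth length-σ⁺₀ k
    length-actLetter (σ⁻ k) = length-atDepth length-σ⁻₀ k

  actᴸ-shift : ∀ us vs w → actᴸ (shiftʷ (length us) w) (us ++ vs) ≡ us ++ actᴸ w vs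
  actᴸ-shift us vs []      = refl
  actᴸ-shift us vs (l ∷ w) = trans (cong (actᴸ (shiftʷ (length us) w)) (actLetter-shift us l))
                                   (actᴸ-shift us _ w)
    where
    atDepth-shift : ∀ f us k → atDepth (length us + k) f (us ++ vs) ≡ us ++ atDepth k f vs
    atDepth-shift f []       k = refl
    atDepth-shift f (u ∷ us) k = cong (u ∷_) (atDepth-shift f us k)
    actLetter-shift : ∀ us l → actLetterᴸ (shift (length us) l) (us ++ vs) ≡ us ++ actLetterᴸ l vs
    actLetter-shift us (σ⁺ k) = atDepth-shift σ⁺₀ us k
    actLetter-shift us (σ⁻ k) = atDepth-shift σ⁻₀ us k

  actᴸ-inverseˡ : ∀ w us → actᴸ (w ⁻¹ʷ) (actᴸ w us) ≡ us
  actᴸ-inverseˡ []      us = refl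
  actᴸ-inverseˡ (l ∷ w) us = begin
    actᴸ (w ⁻¹ʷ ++ [ invert l ]) (actᴸ w (actLetterᴸ l us))
      ≡⟨ actᴸ-++ (w ⁻¹ʷ) _ _ ⟩
    actLetterᴸ (invert l) (actᴸ (w ⁻¹ʷ) (actᴸ w (actLetterᴸ l us)))
      ≡⟨ cong (actLetterᴸ (invert l)) (actᴸ-inverseˡ w _) ⟩
    actLetterᴸ (invert l) (actLetterᴸ l us)
      ≡⟨ invert-cancel l us ⟩
    us ∎
    where
    σ⁻₀σ⁺₀ : ∀ us → σ⁻₀ (σ⁺₀ us) ≡ us
    σ⁻₀σ⁺₀ (u ∷ v ∷ us) = cong (_∷ v ∷ us) (begin
      v ∙ (v ⁻¹ ∙ u ∙ v) ∙ v ⁻¹    ≡⟨ cong (_∙ v ⁻¹) (assoc v _ v) ⟨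
      v ∙ (v ⁻¹ ∙ u) ∙ v ∙ v ⁻¹    ≡⟨ //-rightDividesʳ v _ ⟩
      v ∙ (v ⁻¹ ∙ u)               ≡⟨ \\-leftDividesˡ v u ⟩
      u                            ∎)
    σ⁻₀σ⁺₀ []           = refl
    σ⁻₀σ⁺₀ (u ∷ [])     = refl
    σ⁺₀σ⁻₀ : ∀ us → σ⁺₀ (σ⁻₀ us) ≡ us
    σ⁺₀σ⁻₀ (u ∷ v ∷ us) = cong (u ∷_) (cong (_∷ us) (begin
      u ⁻¹ ∙ (u ∙ v ∙ u ⁻¹) ∙ u    ≡⟨ cong (_∙ u) (assoc (u ⁻¹) (u ∙ v) (u ⁻¹)) ⟨
      u ⁻¹ ∙ (u ∙ v) ∙ u ⁻¹ ∙ u    ≡⟨ //-rightDividesˡ u _ ⟩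
      u ⁻¹ ∙ (u ∙ v)               ≡⟨ \\-leftDividesʳ u v ⟩
      v                            ∎))
    σ⁺₀σ⁻₀ []           = refl
    σ⁺₀σ⁻₀ (u ∷ [])     = refl
    atDepth-cancel : ∀ {f g} → (∀ us → g (f us) ≡ us) → ∀ k us → atDepth k g (atDepth k f us) ≡ us
    atDepth-cancel gf zero    us       = gf us
    atDepth-cancel gf (suc k) []       = refl
    atDepth-cancel gf (suc k) (u ∷ us) = cong (u ∷_) (atDepth-cancel gf k us)
    invert-cancel : ∀ l us → actLetterᴸ (invert l) (actLetterᴸ l us) ≡ us
    invert-cancel (σ⁺ k) = atDepth-cancel σ⁻₀σ⁺₀ k
    invert-cancel (σ⁻ k) = atDepth-cancel σ⁺₀σ⁻₀ k

  actᴸ-inverse-≡ : ∀ w {us vs} → actᴸ w us ≡ vs → actᴸ (w ⁻¹ʷ) vs ≡ us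
  actᴸ-inverse-≡ w {us} refl = actᴸ-inverseˡ w us

  actᴸ-passRight : ∀ y us vs → actᴸ (passRight (length us)) (y ∷ us ++ vs) ≡ us ++ y ^ᶜ ∏ us ∷ vs
  actᴸ-passRight y []       vs = cong (_∷ vs) (sym (^ᶜ-ε y))
  actᴸ-passRight y (u ∷ us) vs = begin
    actᴸ (shiftʷ 1 (passRight (length us))) ([ u ] ++ y ^ᶜ u ∷ us ++ vs)
      ≡⟨ actᴸ-shift [ u ] _ (passRight (length us)) ⟩
    u ∷ actᴸ (passRight (length us)) (y ^ᶜ u ∷ us ++ vs)
      ≡⟨ cong (u ∷_) (actᴸ-passRight (y ^ᶜ u) us vs) ⟩
    u ∷ us ++ y ^ᶜ u ^ᶜ ∏ us ∷ vs
      ≡⟨ cong (λ t → u ∷ us ++ t ∷ vs) (^ᶜ-^ᶜ y u (∏ us)) ⟩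
    u ∷ us ++ y ^ᶜ (u ∙ ∏ us) ∷ vs ∎

  rotate : Carrier → List Carrier → List Carrier
  rotate P []       = []
  rotate P (y ∷ us) = us ++ [ y ^ᶜ P ]

  private
    length-rotate : ∀ P us → length (rotate P us) ≡ length us
    length-rotate P []       = refl
    length-rotate P (y ∷ us) = trans (length-++ us) (+-comm (length us) 1)

    ∏-rotate : ∀ us → ∏ (rotate (∏ us) us) ≡ ∏ us
    ∏-rotate []       = refl
    ∏-rotate (y ∷ us) = begin
      ∏ (us ++ [ y ^ᶜ P ])               ≡⟨ ∏-++ us [ y ^ᶜ P ] ⟩
      ∏ us ∙ (y ^ᶜ P ∙ ε)                ≡⟨ cong (∏ us ∙_) (identityʳ _) ⟩
      ∏ us ∙ (P ⁻¹ ∙ y ∙ P)              ≡⟨ cong (λ t → ∏ us ∙ (t ∙ y ∙ P)) (⁻¹-anti-homo-∙ y (∏ us)) ⟩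
      ∏ us ∙ (∏ us ⁻¹ ∙ y ⁻¹ ∙ y ∙ P)    ≡⟨ cong (λ t → ∏ us ∙ (t ∙ P)) (//-rightDividesˡ y _) ⟩
      ∏ us ∙ (∏ us ⁻¹ ∙ P)               ≡⟨ \\-leftDividesˡ (∏ us) P ⟩
      P                                  ∎
      where P = y ∙ ∏ us

    actᴸ-passRight-rotate : ∀ l us vs → length us ≡ suc l →
                            actᴸ (passRight l) (us ++ vs) ≡ rotate (∏ us) us ++ vs
    actᴸ-passRight-rotate l (y ∷ us) vs refl = begin
      actᴸ (passRight (length us)) (y ∷ us ++ vs)   ≡⟨ actᴸ-passRight y us vs ⟩
      us ++ y ^ᶜ ∏ us ∷ vs                          ≡⟨ cong (λ t → us ++ t ∷ vs) (^ᶜ-absorb y (∏ us)) ⟨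
      us ++ y ^ᶜ (y ∙ ∏ us) ∷ vs                    ≡⟨ ++-assoc us [ y ^ᶜ (y ∙ ∏ us) ] vs ⟨
      (us ++ [ y ^ᶜ (y ∙ ∏ us) ]) ++ vs             ∎

    actᴸ-rotations : ∀ l P k us vs → length us ≡ suc l → ∏ us ≡ P →
                     iter (actᴸ (passRight l)) k (us ++ vs) ≡ iter (rotate P) k us ++ vs
    actᴸ-rotations l P zero    us vs _   _      = refl
    actᴸ-rotations l P (suc k) us vs len refl = begin
      iter (actᴸ (passRight l)) (suc k) (us ++ vs)
        ≡⟨ iter-suc (actᴸ (passRight l)) k _ ⟩
      iter (actᴸ (passRight l)) k (actᴸ (passRight l) (us ++ vs))
        ≡⟨ cong (iter (actᴸ (passRight l)) k) (actᴸ-passRight-rotate l us vs len) ⟩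
      iter (actᴸ (passRight l)) k (rotate P us ++ vs)
        ≡⟨ actᴸ-rotations l P k (rotate P us) vs (trans (length-rotate P us) len) (∏-rotate us) ⟩
      iter (rotate P) k (rotate P us) ++ vs
        ≡⟨ cong (_++ vs) (iter-suc (rotate P) k us) ⟨
      iter (rotate P) (suc k) us ++ vs ∎

    iter-rotate : ∀ P us vs → iter (rotate P) (length us) (us ++ vs) ≡ vs ++ map (_^ᶜ P) us
    iter-rotate P []       vs = sym (++-identityʳ vs)
    iter-rotate P (u ∷ us) vs = begin
      iter (rotate P) (suc (length us)) (u ∷ us ++ vs)
        ≡⟨ iter-suc (rotate P) (length us) _ ⟩
      iter (rotate P) (length us) ((us ++ vs) ++ [ u ^ᶜ P ])
        ≡⟨ cong (iter (rotate P) (length us)) (++-assoc us vs _) ⟩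
      iter (rotate P) (length us) (us ++ vs ++ [ u ^ᶜ P ])
        ≡⟨ iter-rotate P us _ ⟩
      (vs ++ [ u ^ᶜ P ]) ++ map (_^ᶜ P) us
        ≡⟨ ++-assoc vs _ _ ⟩
      vs ++ map (_^ᶜ P) (u ∷ us) ∎

  actᴸ-rotate-by : ∀ l us vs ws → length (us ++ vs) ≡ suc l → ∏ (us ++ vs) ≡ ε →
                   actᴸ (repeatʷ (length us) (passRight l)) (us ++ vs ++ ws) ≡ vs ++ us ++ ws
  actᴸ-rotate-by l us vs ws len ∏≡ε = begin
    actᴸ (repeatʷ (length us) (passRight l)) (us ++ vs ++ ws)
      ≡⟨ actᴸ-repeat (length us) (passRight l) _ ⟩
    iter (actᴸ (passRight l)) (length us) (us ++ vs ++ ws)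
      ≡⟨ cong (iter (actᴸ (passRight l)) (length us)) (++-assoc us vs ws) ⟨
    iter (actᴸ (passRight l)) (length us) ((us ++ vs) ++ ws)
      ≡⟨ actᴸ-rotations l ε (length us) (us ++ vs) ws len ∏≡ε ⟩
    iter (rotate ε) (length us) (us ++ vs) ++ ws
      ≡⟨ cong (_++ ws) (iter-rotate ε us vs) ⟩
    (vs ++ map (_^ᶜ ε) us) ++ ws
      ≡⟨ cong (λ t → (vs ++ t) ++ ws) (trans (map-cong ^ᶜ-ε us) (map-id us)) ⟩
    (vs ++ us) ++ ws
      ≡⟨ ++-assoc vs us ws ⟩
    vs ++ us ++ ws ∎

  actᴸ-full-twist : ∀ l us ws → length us ≡ suc l →
                    actᴸ (repeatʷ (suc l) (passRight l)) (us ++ ws) ≡ map (_^ᶜ ∏ us) us ++ ws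
  actᴸ-full-twist l us ws len = begin
    actᴸ (repeatʷ (suc l) (passRight l)) (us ++ ws)
      ≡⟨ actᴸ-repeat (suc l) (passRight l) _ ⟩
    iter (actᴸ (passRight l)) (suc l) (us ++ ws)
      ≡⟨ actᴸ-rotations l (∏ us) (suc l) us ws len refl ⟩
    iter (rotate (∏ us)) (suc l) us ++ ws
      ≡⟨ cong (λ k → iter (rotate (∏ us)) k us ++ ws) len ⟨
    iter (rotate (∏ us)) (length us) us ++ ws
      ≡⟨ cong (λ t → iter (rotate (∏ us)) (length us) t ++ ws) (++-identityʳ us) ⟨
    iter (rotate (∏ us)) (length us) (us ++ []) ++ ws
      ≡⟨ cong (_++ ws) (iter-rotate (∏ us) us []) ⟩
    map (_^ᶜ ∏ us) us ++ ws ∎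

  -- Out-of-range lookups return ε.
  infixl 9 _‼_
  _‼_ : List Carrier → ℕ → Carrier
  []       ‼ _     = ε
  (u ∷ us) ‼ zero  = u
  (u ∷ us) ‼ suc k = us ‼ k

  ‼-split : ∀ vs k → k < length vs → ∃ λ P → ∃ λ c → ∃ λ Q → vs ≡ P ++ c ∷ Q × length P ≡ k × vs ‼ k ≡ c
  ‼-split (v ∷ vs) zero    _ = [] , v , vs , refl , refl , refl
  ‼-split (v ∷ vs) (suc k) (s≤s k<) with ‼-split vs k k<
  ... | P , c , Q , refl , refl , vs‼k≡c = v ∷ P , c , Q , refl , refl , vs‼k≡c

  ‼-++ : ∀ us vs k → (us ++ vs) ‼ (length us + k) ≡ vs ‼ k
  ‼-++ []       vs k = refl
  ‼-++ (u ∷ us) vs k = ‼-++ us vs k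

-- Layouts of constant blocks

module Blocks (G : FiniteGroup) (L′ : ℕ) (v^L≡ε : ∀ v → GroupFacts._^_ G v (suc L′) ≡ FiniteGroup.ε G) where
  open GroupFacts G
  open ListAction G
  open BlockWords L′
  open ≡-Reasoning

  block : Carrier → List Carrier
  block = replicate L

  layout : List Carrier → List Carrier
  layout []       = []
  layout (v ∷ vs) = block v ++ layout vs

  length-block : ∀ v → length (block v) ≡ L
  length-block v = length-replicate L

  ∏-block : ∀ v → ∏ (block v) ≡ ε
  ∏-block v = trans (∏-replicate L v) (v^L≡ε v)

  length-layout : ∀ vs → length (layout vs) ≡ length vs * L
  length-layout []       = refl
  length-layout (v ∷ vs) = trans (length-++ (block v)) (cong₂ _+_ (length-block v) (length-layout vs))

  ∏-layout : ∀ vs → ∏ (layout vs) ≡ ε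
  ∏-layout []       = refl
  ∏-layout (v ∷ vs) = trans (∏-++ (block v) (layout vs))
      (trans (cong₂ _∙_ (∏-block v) (∏-layout vs)) (identityˡ ε))

  layout-‼ : ∀ vs s → layout vs ‼ (s * L) ≡ vs ‼ s
  layout-‼ []       s       = refl
  layout-‼ (v ∷ vs) zero    = refl
  layout-‼ (v ∷ vs) (suc s) = begin
    (block v ++ layout vs) ‼ (L + s * L)
      ≡⟨ cong (λ k → (block v ++ layout vs) ‼ (k + s * L)) (length-block v) ⟨
    (block v ++ layout vs) ‼ (length (block v) + s * L)
      ≡⟨ ‼-++ (block v) (layout vs) (s * L) ⟩
    layout vs ‼ (s * L)
      ≡⟨ layout-‼ vs s ⟩
    vs ‼ s ∎

  actᴸ-shift-block : ∀ v us w → actᴸ (shiftʷ L w) (block v ++ us) ≡ block v ++ actᴸ w us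
  actᴸ-shift-block v us w = subst (λ k → actᴸ (shiftʷ k w) (block v ++ us) ≡ block v ++ actᴸ w us)
                                  (length-block v) (actᴸ-shift (block v) us w)

  rotateInBlock-act : ∀ v us → actᴸ (passRight L′) (block v ++ us) ≡ block v ++ us
  rotateInBlock-act v us = begin
    actᴸ (repeatʷ (length [ v ]) (passRight L′)) ([ v ] ++ replicate L′ v ++ us)
      ≡⟨ actᴸ-rotate-by L′ [ v ] _ us (cong suc (length-replicate L′)) (∏-block v) ⟩
    replicate L′ v ++ v ∷ us
      ≡⟨ replicate-snoc L′ ⟩
    block v ++ us ∎
    where
    replicate-snoc : ∀ k → replicate k v ++ v ∷ us ≡ v ∷ replicate k v ++ us
    replicate-snoc zero    = refl
    replicate-snoc (suc k) = cong (v ∷_) (replicate-snoc k)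

  blockSwap-act : ∀ a b us → actᴸ blockSwapʷ (block a ++ block b ++ us) ≡ block b ++ block a ++ us
  blockSwap-act a b us = subst
      (λ k → actᴸ (repeatʷ k (passRight (L′ + L))) (block a ++ block b ++ us) ≡ block b ++ block a ++ us)
    (length-block a)
    (actᴸ-rotate-by (L′ + L) (block a) (block b) us
      (trans (length-++ (block a)) (cong₂ _+_ (length-block a) (length-block b)))
      (trans (∏-++ (block a) (block b)) (trans (cong₂ _∙_ (∏-block a) (∏-block b)) (identityˡ ε))))

  -- A full twist conjugates every strand by the product of all of them, which is c here.
  twist-act : ∀ a c us → actᴸ twistʷ (block a ++ block c ++ us) ≡ block (a ^ᶜ c) ++ block c ++ us
  twist-act a c us = begin
    actᴸ twistʷ (block a ++ c ∷ rest)
      ≡⟨ cong (actᴸ twistʷ) (++-assoc (block a) [ c ] rest) ⟨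
    actᴸ twistʷ ((block a ++ [ c ]) ++ rest)
      ≡⟨ actᴸ-full-twist L (block a ++ [ c ]) rest length-a+c ⟩
    map (_^ᶜ ∏ (block a ++ [ c ])) (block a ++ [ c ]) ++ rest
      ≡⟨ cong (λ t → map (_^ᶜ t) (block a ++ [ c ]) ++ rest) ∏-a+c ⟩
    map (_^ᶜ c) (block a ++ [ c ]) ++ rest
      ≡⟨ cong (_++ rest) (map-++ (_^ᶜ c) (block a) [ c ]) ⟩
    (map (_^ᶜ c) (block a) ++ [ c ^ᶜ c ]) ++ rest
      ≡⟨ cong₂ (λ s t → (s ++ [ t ]) ++ rest) (map-replicate (_^ᶜ c) L a) (^ᶜ-self c) ⟩
    (block (a ^ᶜ c) ++ [ c ]) ++ rest
      ≡⟨ ++-assoc (block (a ^ᶜ c)) [ c ] rest ⟩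
    block (a ^ᶜ c) ++ block c ++ us ∎
    where
    rest = replicate L′ c ++ us
    length-a+c : length (block a ++ [ c ]) ≡ suc L
    length-a+c = trans (length-++ (block a)) (trans (cong (_+ 1) (length-block a)) (+-comm L 1))
    ∏-a+c : ∏ (block a ++ [ c ]) ≡ c
    ∏-a+c = trans (∏-++ (block a) [ c ]) (trans (cong₂ _∙_ (∏-block a) (identityʳ c)) (identityˡ c))

  moveRoot-act : ∀ a P Q → actᴸ (moveRootʷ (length P)) (layout (a ∷ P ++ Q)) ≡ layout (P ++ a ∷ Q)
  moveRoot-act a []      Q = refl
  moveRoot-act a (p ∷ P) Q = begin
    actᴸ (blockSwapʷ ++ shiftʷ L (moveRootʷ (length P))) (block a ++ block p ++ layout (P ++ Q))
      ≡⟨ actᴸ-++ blockSwapʷ _ _ ⟩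
    actᴸ (shiftʷ L (moveRootʷ (length P))) (actᴸ blockSwapʷ (block a ++ block p ++ layout (P ++ Q)))
      ≡⟨ cong (actᴸ (shiftʷ L (moveRootʷ (length P)))) (blockSwap-act a p _) ⟩
    actᴸ (shiftʷ L (moveRootʷ (length P))) (block p ++ layout (a ∷ P ++ Q))
      ≡⟨ actᴸ-shift-block p _ (moveRootʷ (length P)) ⟩
    block p ++ actᴸ (moveRootʷ (length P)) (layout (a ∷ P ++ Q))
      ≡⟨ cong (block p ++_) (moveRoot-act a P Q) ⟩
    block p ++ layout (P ++ a ∷ Q) ∎

  swapRoot-act : ∀ a P b Q → actᴸ (swapRootʷ (length P)) (layout (a ∷ P ++ b ∷ Q)) ≡ layout (b ∷ P ++ a ∷ Q)
  swapRoot-act a P b Q = begin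
    actᴸ (moveRootʷ (suc (length P)) ++ moveRootʷ (length P) ⁻¹ʷ) (layout (a ∷ P ++ b ∷ Q))
      ≡⟨ actᴸ-++ (moveRootʷ (suc (length P))) _ _ ⟩
    actᴸ (moveRootʷ (length P) ⁻¹ʷ) (actᴸ (moveRootʷ (suc (length P))) (layout (a ∷ P ++ b ∷ Q)))
      ≡⟨ cong (actᴸ (moveRootʷ (length P) ⁻¹ʷ)) move-past-b ⟩
    actᴸ (moveRootʷ (length P) ⁻¹ʷ) (layout (P ++ b ∷ a ∷ Q))
      ≡⟨ actᴸ-inverse-≡ (moveRootʷ (length P)) (moveRoot-act b P (a ∷ Q)) ⟩
    layout (b ∷ P ++ a ∷ Q) ∎
    where
    length-P+b : length (P ++ [ b ]) ≡ suc (length P)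
    length-P+b = trans (length-++ P) (+-comm (length P) 1)
    move-past-b : actᴸ (moveRootʷ (suc (length P))) (layout (a ∷ P ++ b ∷ Q)) ≡ layout (P ++ b ∷ a ∷ Q)
    move-past-b = begin
      actᴸ (moveRootʷ (suc (length P))) (layout (a ∷ P ++ b ∷ Q))
        ≡⟨ cong₂ (λ k t → actᴸ (moveRootʷ k) (layout (a ∷ t))) length-P+b (++-assoc P [ b ] Q) ⟨
      actᴸ (moveRootʷ (length (P ++ [ b ]))) (layout (a ∷ (P ++ [ b ]) ++ Q))
        ≡⟨ moveRoot-act a (P ++ [ b ]) Q ⟩
      layout ((P ++ [ b ]) ++ a ∷ Q)
        ≡⟨ cong layout (++-assoc P [ b ] (a ∷ Q)) ⟩
      layout (P ++ b ∷ a ∷ Q) ∎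

  conjugateRoot-act : ∀ a P c Q →
                      actᴸ (conjugateRootʷ (length P)) (layout (a ∷ P ++ c ∷ Q)) ≡ layout (a ^ᶜ c ∷ P ++ c ∷ Q)
  conjugateRoot-act a P c Q = begin
    actᴸ (shiftʷ L (M ⁻¹ʷ) ++ twistʷ ++ shiftʷ L M) (block a ++ layout (P ++ c ∷ Q))
      ≡⟨ actᴸ-++ (shiftʷ L (M ⁻¹ʷ)) _ _ ⟩
    actᴸ (twistʷ ++ shiftʷ L M) (actᴸ (shiftʷ L (M ⁻¹ʷ)) (block a ++ layout (P ++ c ∷ Q)))
      ≡⟨ cong (actᴸ (twistʷ ++ shiftʷ L M)) (actᴸ-shift-block a _ (M ⁻¹ʷ)) ⟩
    actᴸ (twistʷ ++ shiftʷ L M) (block a ++ actᴸ (M ⁻¹ʷ) (layout (P ++ c ∷ Q)))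
      ≡⟨ cong (λ t → actᴸ (twistʷ ++ shiftʷ L M) (block a ++ t)) (actᴸ-inverse-≡ M (moveRoot-act c P Q)) ⟩
    actᴸ (twistʷ ++ shiftʷ L M) (block a ++ block c ++ layout (P ++ Q))
      ≡⟨ actᴸ-++ twistʷ _ _ ⟩
    actᴸ (shiftʷ L M) (actᴸ twistʷ (block a ++ block c ++ layout (P ++ Q)))
      ≡⟨ cong (actᴸ (shiftʷ L M)) (twist-act a c _) ⟩
    actᴸ (shiftʷ L M) (block (a ^ᶜ c) ++ layout (c ∷ P ++ Q))
      ≡⟨ actᴸ-shift-block (a ^ᶜ c) _ M ⟩
    block (a ^ᶜ c) ++ actᴸ M (layout (c ∷ P ++ Q))
      ≡⟨ cong (block (a ^ᶜ c) ++_) (moveRoot-act c P Q) ⟩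
    layout (a ^ᶜ c ∷ P ++ c ∷ Q) ∎
    where M = moveRootʷ (length P)

  conjugateRoot-act′ : ∀ a V q → q < length V →
                       actᴸ (conjugateRootʷ q) (layout (a ∷ V)) ≡ layout (a ^ᶜ (V ‼ q) ∷ V)
  conjugateRoot-act′ a V q q<|V| with ‼-split V q q<|V|
  ... | P , c , Q , refl , refl , V‼q≡c = trans (conjugateRoot-act a P c Q)
      (cong (λ t → layout (a ^ᶜ t ∷ P ++ c ∷ Q)) (sym V‼q≡c))

  conjugateRootBy-act : ∀ qs a V → All (_< length V) qs →
                        actᴸ (conjugateRootByʷ qs) (layout (a ∷ V)) ≡ layout (a ^ᶜ ∏ (map (V ‼_) qs) ∷ V)
  conjugateRootBy-act []       a V []           = cong (λ t → layout (t ∷ V)) (sym (^ᶜ-ε a))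
  conjugateRootBy-act (q ∷ qs) a V (q< ∷ qs<) = begin
    actᴸ (conjugateRootʷ q ++ conjugateRootByʷ qs) (layout (a ∷ V))
      ≡⟨ actᴸ-++ (conjugateRootʷ q) _ _ ⟩
    actᴸ (conjugateRootByʷ qs) (actᴸ (conjugateRootʷ q) (layout (a ∷ V)))
      ≡⟨ cong (actᴸ (conjugateRootByʷ qs)) (conjugateRoot-act′ a V q q<) ⟩
    actᴸ (conjugateRootByʷ qs) (layout (a ^ᶜ (V ‼ q) ∷ V))
      ≡⟨ conjugateRootBy-act qs _ V qs< ⟩
    layout (a ^ᶜ (V ‼ q) ^ᶜ ∏ (map (V ‼_) qs) ∷ V)
      ≡⟨ cong (λ t → layout (t ∷ V)) (^ᶜ-^ᶜ a _ _) ⟩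
    layout (a ^ᶜ ∏ (map (V ‼_) (q ∷ qs)) ∷ V) ∎

  join-act : ∀ qs a P b Q → All (_< length (P ++ b ∷ Q)) qs → a ^ᶜ ∏ (map ((P ++ b ∷ Q) ‼_) qs) ≡ b →
             actᴸ (joinʷ qs (length P)) (layout (a ∷ P ++ b ∷ Q)) ≡ layout (a ∷ P ++ b ∷ Q)
  join-act qs a P b Q qs< conjugates-to-b = begin
    actᴸ (C ++ swapRootʷ (length P) ++ C ⁻¹ʷ) (layout (a ∷ V))
      ≡⟨ actᴸ-++ C _ _ ⟩
    actᴸ (swapRootʷ (length P) ++ C ⁻¹ʷ) (actᴸ C (layout (a ∷ V)))
      ≡⟨ cong (actᴸ (swapRootʷ (length P) ++ C ⁻¹ʷ)) root-to-b ⟩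
    actᴸ (swapRootʷ (length P) ++ C ⁻¹ʷ) (layout (b ∷ V))
      ≡⟨ actᴸ-++ (swapRootʷ (length P)) _ _ ⟩
    actᴸ (C ⁻¹ʷ) (actᴸ (swapRootʷ (length P)) (layout (b ∷ V)))
      ≡⟨ cong (actᴸ (C ⁻¹ʷ)) (swapRoot-act b P b Q) ⟩
    actᴸ (C ⁻¹ʷ) (layout (b ∷ V))
      ≡⟨ actᴸ-inverse-≡ C root-to-b ⟩
    layout (a ∷ V) ∎
    where
    V = P ++ b ∷ Q
    C = conjugateRootByʷ qs
    root-to-b : actᴸ C (layout (a ∷ V)) ≡ layout (b ∷ V)
    root-to-b = trans (conjugateRootBy-act qs a V qs<) (cong (λ t → layout (t ∷ V)) conjugates-to-b)

-- From words and lists to braids and tuples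

private
  transposition-here : ∀ k → transposition k k ≡ suc k
  transposition-here zero    = refl
  transposition-here (suc k) = cong suc (transposition-here k)

  transposition-next : ∀ k → transposition k (suc k) ≡ k
  transposition-next zero    = refl
  transposition-next (suc k) = cong suc (transposition-next k)

  transposition-other : ∀ k j → j ≢ k → j ≢ suc k → transposition k j ≡ j
  transposition-other zero    zero          j≢k _   = contradiction refl j≢k
  transposition-other zero    (suc zero)    _   j≢k+1 = contradiction refl j≢k+1
  transposition-other zero    (suc (suc j)) _   _   = refl
  transposition-other (suc k) zero          _   _   = refl
  transposition-other (suc k) (suc j)       j≢k j≢k+1 = cong suc
      (transposition-other k j (j≢k ∘ cong suc) (j≢k+1 ∘ cong suc))

  ne-inject₁ : ∀ {m} {i : Fin m} {j} → j ≢ inject₁ i → toℕ j ≢ toℕ i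
  ne-inject₁ {i = i} j≢i eq = j≢i (toℕ-injective (trans eq (sym (toℕ-inject₁ i))))

  ne-suc : ∀ {m} {i : Fin m} {j} → j ≢ suc i → toℕ j ≢ suc (toℕ i)
  ne-suc j≢i eq = j≢i (toℕ-injective eq)

  swap-transposition : ∀ {m} (i : Fin m) j → toℕ (swapLetter (σ i) j) ≡ transposition (toℕ i) (toℕ j)
  swap-transposition i j with j Fin.≟ inject₁ i | j Fin.≟ suc i
  ... | yes refl | _ = sym
      (trans (cong (λ t → transposition (toℕ i) t) (toℕ-inject₁ i)) (transposition-here (toℕ i)))
  ... | no _ | yes refl = trans (toℕ-inject₁ i) (sym (transposition-next (toℕ i)))
  ... | no j≢i | no j≢i+1 = sym (transposition-other (toℕ i) (toℕ j) (ne-inject₁ j≢i) (ne-suc j≢i+1))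

  swap⁻¹-transposition : ∀ {m} (i : Fin m) j → toℕ (swapLetter (σ⁻¹ i) j) ≡ transposition (toℕ i) (toℕ j)
  swap⁻¹-transposition i j with j Fin.≟ inject₁ i | j Fin.≟ suc i
  ... | yes refl | _ = sym
      (trans (cong (λ t → transposition (toℕ i) t) (toℕ-inject₁ i)) (transposition-here (toℕ i)))
  ... | no _ | yes refl = trans (toℕ-inject₁ i) (sym (transposition-next (toℕ i)))
  ... | no j≢i | no j≢i+1 = sym (transposition-other (toℕ i) (toℕ j) (ne-inject₁ j≢i) (ne-suc j≢i+1))

toLetter : ∀ m (l : Letterℕ) → suc (index l) < suc m → Letter (suc m)
toLetter m (σ⁺ k) k<m = σ (fromℕ< (≤-pred k<m))
toLetter m (σ⁻ k) k<m = σ⁻¹ (fromℕ< (≤-pred k<m))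

toBraid : ∀ m (w : Wordℕ) → Bounded (suc m) w → Braid (suc m)
toBraid m []      []          = []
toBraid m (l ∷ w) (l< ∷ w<) = toLetter m l l< ∷ toBraid m w w<

perm-toBraid : ∀ m w (w< : Bounded (suc m) w) j → toℕ (perm (toBraid m w w<) j) ≡ permℕ w (toℕ j)
perm-toBraid m []           []          j = refl
perm-toBraid m (σ⁺ k ∷ w) (k< ∷ w<) j = trans (perm-toBraid m w w< _)
  (cong (permℕ w) (trans (swap-transposition _ j) (cong (λ t → transposition t (toℕ j)) (toℕ-fromℕ< _))))
perm-toBraid m (σ⁻ k ∷ w) (k< ∷ w<) j = trans (perm-toBraid m w w< _)
  (cong (permℕ w) (trans (swap⁻¹-transposition _ j) (cong (λ t → transposition t (toℕ j)) (toℕ-fromℕ< _))))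

iter-perm-toBraid : ∀ m w (w< : Bounded (suc m) w) k j →
                    toℕ (iter (perm (toBraid m w w<)) k j) ≡ iter (permℕ w) k (toℕ j)
iter-perm-toBraid m w w< zero    j = refl
iter-perm-toBraid m w w< (suc k) j = trans (perm-toBraid m w w< _)
    (cong (permℕ w) (iter-perm-toBraid m w w< k j))

isNCycle-toBraid : ∀ m w (w< : Bounded (suc m) w) → IsCycleOn (permℕ w) (suc m) →
                   IsNCycle (perm (toBraid m w w<))
isNCycle-toBraid m w w< cycle i j with IsCycleOn.transitive cycle (toℕ i) (toℕ j) (toℕ<n i) (toℕ<n j)
... | k , πᵏi≡j = k , toℕ-injective (trans (iter-perm-toBraid m w w< k i) πᵏi≡j)

module Correspondence (G : FiniteGroup) where
  open GroupFacts G
  open ListAction G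

  Represents : ∀ {n} → (Fin n → Carrier) → List Carrier → Set
  Represents {n} g us = length us ≡ n × (∀ j → g j ≡ us ‼ toℕ j)

  private
    σ⁺-here : ∀ k us → suc k < length us → actLetterᴸ (σ⁺ k) us ‼ k ≡ us ‼ suc k
    σ⁺-here zero    (u ∷ v ∷ us) _         = refl
    σ⁺-here zero    (u ∷ [])     (s≤s ())
    σ⁺-here (suc k) (u ∷ us)     (s≤s k<) = σ⁺-here k us k<

    σ⁺-next : ∀ k us → suc k < length us → actLetterᴸ (σ⁺ k) us ‼ suc k ≡ us ‼ k ^ᶜ us ‼ suc k
    σ⁺-next zero    (u ∷ v ∷ us) _         = refl
    σ⁺-next zero    (u ∷ [])     (s≤s ())
    σ⁺-next (suc k) (u ∷ us)     (s≤s k<) = σ⁺-next k us k<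

    σ⁻-here : ∀ k us → suc k < length us → actLetterᴸ (σ⁻ k) us ‼ k ≡ us ‼ k ∙ us ‼ suc k ∙ us ‼ k ⁻¹
    σ⁻-here zero    (u ∷ v ∷ us) _         = refl
    σ⁻-here zero    (u ∷ [])     (s≤s ())
    σ⁻-here (suc k) (u ∷ us)     (s≤s k<) = σ⁻-here k us k<

    σ⁻-next : ∀ k us → suc k < length us → actLetterᴸ (σ⁻ k) us ‼ suc k ≡ us ‼ k
    σ⁻-next zero    (u ∷ v ∷ us) _         = refl
    σ⁻-next zero    (u ∷ [])     (s≤s ())
    σ⁻-next (suc k) (u ∷ us)     (s≤s k<) = σ⁻-next k us k<

    atDepth-other : ∀ {f} → (∀ us j → f us ‼ suc (suc j) ≡ us ‼ suc (suc j)) →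
                    ∀ k us j → j ≢ k → j ≢ suc k → atDepth k f us ‼ j ≡ us ‼ j
    atDepth-other f-fixes zero    us       zero          j≢k _     = contradiction refl j≢k
    atDepth-other f-fixes zero    us       (suc zero)    _   j≢k+1 = contradiction refl j≢k+1
    atDepth-other f-fixes zero    us       (suc (suc j)) _   _     = f-fixes us j
    atDepth-other f-fixes (suc k) []       j             _   _     = refl
    atDepth-other f-fixes (suc k) (u ∷ us) zero          _   _     = refl
    atDepth-other f-fixes (suc k) (u ∷ us) (suc j)       j≢k j≢k+1 =
      atDepth-other f-fixes k us j (j≢k ∘ cong suc) (j≢k+1 ∘ cong suc)

    σ⁺₀-fixes : ∀ us j → σ⁺₀ us ‼ suc (suc j) ≡ us ‼ suc (suc j)
    σ⁺₀-fixes []           j = refl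
    σ⁺₀-fixes (u ∷ [])     j = refl
    σ⁺₀-fixes (u ∷ v ∷ us) j = refl

    σ⁻₀-fixes : ∀ us j → σ⁻₀ us ‼ suc (suc j) ≡ us ‼ suc (suc j)
    σ⁻₀-fixes []           j = refl
    σ⁻₀-fixes (u ∷ [])     j = refl
    σ⁻₀-fixes (u ∷ v ∷ us) j = refl

  module _ {m} (g : Fin (suc m) → Carrier) (us : List Carrier) (g≈us : Represents g us) (i : Fin m) where
    private
      k = toℕ i
      k+1<|us| : suc k < length us
      k+1<|us| = subst (suc k <_) (sym (proj₁ g≈us)) (s≤s (toℕ<n i))
      at = proj₂ g≈us
      at-k : g (inject₁ i) ≡ us ‼ k
      at-k = trans (at (inject₁ i)) (cong (us ‼_) (toℕ-inject₁ i))

    represents-σ : Represents (actLetter G (σ i) g) (actLetterᴸ (σ⁺ k) us)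
    represents-σ = trans (length-actᴸ [ σ⁺ k ] us) (proj₁ g≈us) , entry
      where
      entry : ∀ j → actLetter G (σ i) g j ≡ actLetterᴸ (σ⁺ k) us ‼ toℕ j
      entry j with j Fin.≟ inject₁ i | j Fin.≟ suc i
      ... | yes refl | _ = trans (at (suc i))
          (sym (trans (cong (actLetterᴸ (σ⁺ k) us ‼_) (toℕ-inject₁ i)) (σ⁺-here k us k+1<|us|)))
      ... | no _ | yes refl = trans (cong₂ _^ᶜ_ at-k (at (suc i))) (sym (σ⁺-next k us k+1<|us|))
      ... | no j≢i | no j≢i+1 = trans (at j)
          (sym (atDepth-other σ⁺₀-fixes k us (toℕ j) (ne-inject₁ j≢i) (ne-suc j≢i+1)))

    represents-σ⁻¹ : Represents (actLetter G (σ⁻¹ i) g) (actLetterᴸ (σ⁻ k) us)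
    represents-σ⁻¹ = trans (length-actᴸ [ σ⁻ k ] us) (proj₁ g≈us) , entry
      where
      entry : ∀ j → actLetter G (σ⁻¹ i) g j ≡ actLetterᴸ (σ⁻ k) us ‼ toℕ j
      entry j with j Fin.≟ inject₁ i | j Fin.≟ suc i
      ... | yes refl | _ = trans (cong₂ (λ a b → a ∙ b ∙ a ⁻¹) at-k (at (suc i)))
          (sym (trans (cong (actLetterᴸ (σ⁻ k) us ‼_) (toℕ-inject₁ i)) (σ⁻-here k us k+1<|us|)))
      ... | no _ | yes refl = trans at-k (sym (σ⁻-next k us k+1<|us|))
      ... | no j≢i | no j≢i+1 = trans (at j)
          (sym (atDepth-other σ⁻₀-fixes k us (toℕ j) (ne-inject₁ j≢i) (ne-suc j≢i+1)))

  represents-act : ∀ m w (w< : Bounded (suc m) w) g us → Represents g us →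
                   Represents (act G (toBraid m w w<) g) (actᴸ w us)
  represents-act m []           []          g us g≈us = g≈us
  represents-act m (σ⁺ k ∷ w) (k< ∷ w<) g us g≈us with fromℕ< (≤-pred k<) | toℕ-fromℕ< (≤-pred k<)
  ... | i | refl = represents-act m w w< _ _ (represents-σ g us g≈us i)
  represents-act m (σ⁻ k ∷ w) (k< ∷ w<) g us g≈us with fromℕ< (≤-pred k<) | toℕ-fromℕ< (≤-pred k<)
  ... | i | refl = represents-act m w w< _ _ (represents-σ⁻¹ g us g≈us i)

  represents-prod : ∀ {n} (g : Fin n → Carrier) us → Represents g us → prod G g ≡ ∏ us
  represents-prod {zero}  g []       _            = refl
  represents-prod {suc n} g (u ∷ us) (len , at) =
    cong₂ _∙_ (at zero) (represents-prod (g ∘ suc) us (suc-injective len , at ∘ suc))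

  act-toBraid-fixes : ∀ m w (w< : Bounded (suc m) w) g us → Represents g us → actᴸ w us ≡ us →
                      ∀ i → act G (toBraid m w w<) g i ≡ g i
  act-toBraid-fixes m w w< g us g≈us w-fixes i = begin
    act G (toBraid m w w<) g i    ≡⟨ proj₂ (represents-act m w w< g us g≈us) i ⟩
    actᴸ w us ‼ toℕ i             ≡⟨ cong (_‼ toℕ i) w-fixes ⟩
    us ‼ toℕ i                    ≡⟨ proj₂ g≈us i ⟨
    g i                           ∎
    where open ≡-Reasoning

module StabilisingCycle (G : FiniteGroup) (L′ : ℕ)
                        (v^L≡ε : ∀ v → GroupFacts._^_ G v (suc L′) ≡ FiniteGroup.ε G) where
  open GroupFacts G
  open ListAction G
  open BlockWords L′
  open Blocks G L′ v^L≡ε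

  module _ (a : Carrier) (V : List Carrier)
           (reach : ∀ r → r < length V → ∃ λ qs → All (_< length V) qs × a ^ᶜ ∏ (map (V ‼_) qs) ≡ V ‼ r) where

    private
      W : ∀ k → k ≤ length V → Wordℕ
      W zero    _   = passRight L′
      W (suc k) k<V = W k (<⇒≤ k<V) ++ joinʷ (proj₁ (reach k k<V)) k

      join-stabilises : ∀ k k<V → actᴸ (joinʷ (proj₁ (reach k k<V)) k) (layout (a ∷ V)) ≡ layout (a ∷ V)
      join-stabilises k k<V with reach k k<V | ‼-split V k k<V
      ... | qs , qs< , a↦V‼k | P , b , Q , refl , refl , V‼k≡b = join-act qs a P b Q qs< (trans a↦V‼k V‼k≡b)

      W-stabilises : ∀ k k≤V → actᴸ (W k k≤V) (layout (a ∷ V)) ≡ layout (a ∷ V)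
      W-stabilises zero    _   = rotateInBlock-act a (layout V)
      W-stabilises (suc k) k<V = trans (actᴸ-++ (W k _) _ _)
        (trans (cong (actᴸ (joinʷ (proj₁ (reach k k<V)) k)) (W-stabilises k (<⇒≤ k<V))) (join-stabilises k k<V))

      W-bounded : ∀ k k≤V → Bounded (suc (length V) * L) (W k k≤V)
      W-bounded zero    _   = Bounded-mono (m≤m+n L _) (Bounded-passRight L′)
      W-bounded (suc k) k<V = ++⁺ (W-bounded k (<⇒≤ k<V))
          (Bounded-join (length V) _ k (proj₁ (proj₂ (reach k k<V))) k<V)

      W-cycle : ∀ k k≤V → IsCycleOn (permℕ (W k k≤V)) (suc k * L)
      W-cycle zero    _   = subst (IsCycleOn (permℕ (passRight L′))) (sym (+-identityʳ L)) (passRight-cycle L′)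
      W-cycle (suc k) k<V = subst (IsCycleOn _) (+-comm (suc k * L) L)
        (IsCycleOn-cong (λ p → sym (trans (permℕ-++ (W k _) (joinʷ qs k) p) (join-perm qs k _)))
          (cycle-merge (m≤m+n L (k * L)) (W-cycle k (<⇒≤ k<V))
            (swapRoot-root k) (swapRoot-target k) (swapRoot-between k)
            (λ p → swapRoot-beyond k p ∘ subst (_≤ p) (+-comm (suc k * L) L))))
        where
        qs = proj₁ (reach k k<V)

    stabilising-cycle : ∃ λ w → actᴸ w (layout (a ∷ V)) ≡ layout (a ∷ V)
                              × Bounded (suc (length V) * L) w
                              × IsCycleOn (permℕ w) (suc (length V) * L)
    stabilising-cycle = W (length V) ≤-refl
                      , W-stabilises (length V) ≤-refl
                      , W-bounded (length V) ≤-refl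
                      , W-cycle (length V) ≤-refl

module ConjugateLayout (G : FiniteGroup) (simple : IsSimple G)
                       (x : Fin (FiniteGroup.order G)) (x≢ε : x ≢ FiniteGroup.ε G) where
  open GroupFacts G
  open ListAction G
  open NormalClosure G x
  open ≡-Reasoning

  conjugates : List Carrier
  conjugates = tabulate conjugate

  private
    order>0 : 0 < order
    order>0 = inhabited x
      where
      inhabited : ∀ {n} → Fin n → 0 < n
      inhabited {suc n} _ = s≤s z≤n

    ‼-tabulate : ∀ {n} (f : Fin n → Carrier) i → tabulate f ‼ toℕ i ≡ f i
    ‼-tabulate f zero    = refl
    ‼-tabulate f (suc i) = ‼-tabulate (λ j → f (suc j)) i

  root : Carrier
  root = fromℕ< order>0

  rest : List Carrier
  rest = drop 1 conjugates

  conjugates-split : conjugates ≡ conjugate root ∷ rest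
  conjugates-split = split conjugates (subst (0 <_) (sym (length-tabulate conjugate)) order>0)
                           (trans (cong (conjugates ‼_) (sym (toℕ-fromℕ< order>0))) (‼-tabulate conjugate root))
    where
    split : ∀ us {u} → 0 < length us → us ‼ 0 ≡ u → us ≡ u ∷ drop 1 us
    split (u ∷ us) _ refl = refl

  private
    length-rest : length rest ≡ order ∸ 1
    length-rest = trans (length-drop 1 conjugates) (cong (_∸ 1) (length-tabulate conjugate))

    rest-‼ : ∀ b t → toℕ b ≡ suc t → rest ‼ t ≡ conjugate b
    rest-‼ b t b≡t+1 = trans (drop-‼ conjugates)
        (trans (cong (conjugates ‼_) (sym b≡t+1)) (‼-tabulate conjugate b))
      where
      drop-‼ : ∀ us → drop 1 us ‼ t ≡ us ‼ suc t
      drop-‼ []       = refl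
      drop-‼ (u ∷ us) = refl

    position : ∀ b → b ≢ root → ∃ λ t → t < length rest × rest ‼ t ≡ conjugate b
    position b b≢root with toℕ b in b≡
    ... | zero  = contradiction (toℕ-injective (trans b≡ (sym (toℕ-fromℕ< order>0)))) b≢root
    ... | suc t = t , subst (t <_) (sym length-rest)
        (≤-pred (subst₂ _<_ b≡ (sym (m+[n∸m]≡n order>0)) (toℕ<n b)))
                    , rest-‼ b t b≡

    conjugate-∙x : ∀ b → conjugate (b ∙ x) ≡ conjugate b
    conjugate-∙x b = begin
      b ∙ x ∙ x ∙ (b ∙ x) ⁻¹          ≡⟨ cong (b ∙ x ∙ x ∙_) (⁻¹-anti-homo-∙ b x) ⟩
      b ∙ x ∙ x ∙ (x ⁻¹ ∙ b ⁻¹)       ≡⟨ assoc (b ∙ x ∙ x) (x ⁻¹) (b ⁻¹) ⟨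
      b ∙ x ∙ x ∙ x ⁻¹ ∙ b ⁻¹         ≡⟨ cong (_∙ b ⁻¹) (//-rightDividesʳ x (b ∙ x)) ⟩
      b ∙ x ∙ b ⁻¹                    ∎

  -- conjugate (b ∙ x) ≡ conjugate b, so even the value of the root block recurs among the others.
  occurs-in-rest : ∀ b → ∃ λ t → t < length rest × rest ‼ t ≡ conjugate b
  occurs-in-rest b with b Fin.≟ root
  ... | no b≢root = position b b≢root
  ... | yes refl with position (root ∙ x) (λ eq → x≢ε (∙-cancelˡ root x ε (trans eq (sym (identityʳ root)))))
  ...   | t , t< , rest‼t = t , t< , trans rest‼t (conjugate-∙x root)

  private
    conjugate≡^ᶜ : ∀ b → conjugate b ≡ x ^ᶜ b ⁻¹
    conjugate≡^ᶜ b = cong (λ t → t ∙ x ∙ b ⁻¹) (sym (⁻¹-involutive b))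

    conjugate-^ᶜ : ∀ u b → conjugate u ^ᶜ (u ∙ b ⁻¹) ≡ conjugate b
    conjugate-^ᶜ u b = begin
      conjugate u ^ᶜ (u ∙ b ⁻¹)        ≡⟨ cong (_^ᶜ (u ∙ b ⁻¹)) (conjugate≡^ᶜ u) ⟩
      x ^ᶜ u ⁻¹ ^ᶜ (u ∙ b ⁻¹)          ≡⟨ ^ᶜ-^ᶜ x (u ⁻¹) (u ∙ b ⁻¹) ⟩
      x ^ᶜ (u ⁻¹ ∙ (u ∙ b ⁻¹))         ≡⟨ cong (x ^ᶜ_) (\\-leftDividesʳ u (b ⁻¹)) ⟩
      x ^ᶜ b ⁻¹                        ≡⟨ conjugate≡^ᶜ b ⟨
      conjugate b                      ∎

    rest-index : Carrier → ℕ
    rest-index c = proj₁ (occurs-in-rest c)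

    ∏-indices : ∀ cs → ∏ (map (rest ‼_) (map rest-index cs)) ≡ conjProduct cs
    ∏-indices []       = refl
    ∏-indices (c ∷ cs) = cong₂ _∙_ (proj₂ (proj₂ (occurs-in-rest c))) (∏-indices cs)

    indices-bounded : ∀ cs → All (_< length rest) (map rest-index cs)
    indices-bounded []       = []
    indices-bounded (c ∷ cs) = proj₁ (proj₂ (occurs-in-rest c)) ∷ indices-bounded cs

    rest-conjugate : ∀ r → r < length rest → ∃ λ b → rest ‼ r ≡ conjugate b
    rest-conjugate r r< = fromℕ< r+1<order , rest-‼ _ r (toℕ-fromℕ< r+1<order)
      where
      r+1<order : suc r < order
      r+1<order = subst (suc (suc r) ≤_) (m+[n∸m]≡n order>0) (s≤s (subst (r <_) length-rest r<))

  root-reaches-rest : ∀ r → r < length rest →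
                      ∃ λ qs → All (_< length rest) qs × conjugate root ^ᶜ ∏ (map (rest ‼_) qs) ≡ rest ‼ r
  root-reaches-rest r r< with rest-conjugate r r<
  ... | b , rest‼r≡ with products-of-conjugates simple x≢ε (root ∙ b ⁻¹)
  ...   | cs , cs≡ = map rest-index cs , indices-bounded cs , (begin
    conjugate root ^ᶜ ∏ (map (rest ‼_) (map rest-index cs))   ≡⟨ cong (conjugate root ^ᶜ_) (∏-indices cs) ⟩
    conjugate root ^ᶜ conjProduct cs                      ≡⟨ cong (conjugate root ^ᶜ_) cs≡ ⟩
    conjugate root ^ᶜ (root ∙ b ⁻¹)                       ≡⟨ conjugate-^ᶜ root b ⟩
    conjugate b                                           ≡⟨ rest‼r≡ ⟨
    rest ‼ r                                              ∎)

module Construction (G : FiniteGroup) (simple : IsSimple G) (m q : ℕ)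
                    (n≡q*N² : suc m ≡ q * (FiniteGroup.order G * FiniteGroup.order G)) where
  open GroupFacts G
  open ListAction G
  open Correspondence G

  private
    N = order

    x : Carrier
    x = proj₁ (nontrivial-element (proj₁ simple))

    x≢ε : x ≢ ε
    x≢ε = proj₂ (nontrivial-element (proj₁ simple))

    L′ : ℕ
    L′ = q * N ∸ 1

    qN>0 : 0 < q * N
    qN>0 = positive q n≡q*N²
      where
      positive : ∀ q → suc m ≡ q * (N * N) → 0 < q * N
      positive (suc q′) _ = ≤-trans (<⇒≤ (proj₁ simple)) (m≤n*m N (suc q′))

    L≡qN : suc L′ ≡ q * N
    L≡qN = m+[n∸m]≡n qN>0

    v^L≡ε : ∀ v → v ^ suc L′ ≡ ε
    v^L≡ε v = trans (cong (v ^_) L≡qN) (^-multiple-of-order G q v)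

  open NormalClosure G x
  open ConjugateLayout G simple x x≢ε
  open BlockWords L′ using (L)
  open Blocks G L′ v^L≡ε
  open StabilisingCycle G L′ v^L≡ε

  private
    T : List Carrier
    T = layout (conjugate root ∷ rest)

    blocks≡N : suc (length rest) ≡ N
    blocks≡N = trans (cong length (sym conjugates-split)) (length-tabulate conjugate)

    n≡|T| : suc m ≡ suc (length rest) * L
    n≡|T| = begin
      suc m                    ≡⟨ n≡q*N² ⟩
      q * (N * N)              ≡⟨ *-assoc q N N ⟨
      q * N * N                ≡⟨ *-comm (q * N) N ⟩
      N * (q * N)              ≡⟨ cong₂ _*_ blocks≡N L≡qN ⟨
      suc (length rest) * L    ∎
      where open ≡-Reasoning

    stabiliser = stabilising-cycle (conjugate root) rest root-reaches-rest
    w = proj₁ stabiliser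

    w-bounded : Bounded (suc m) w
    w-bounded = subst (λ B → Bounded B w) (sym n≡|T|) (proj₁ (proj₂ (proj₂ stabiliser)))

  tuple : Fin (suc m) → Carrier
  tuple j = T ‼ toℕ j

  braid : Braid (suc m)
  braid = toBraid m w w-bounded

  tuple-represents-T : Represents tuple T
  tuple-represents-T = trans (length-layout (conjugate root ∷ rest)) (sym n≡|T|) , λ _ → refl

  tuple-generates : Generates G tuple
  tuple-generates = conjugates-generate simple x≢ε tuple conjugate∈
    where
    conjugate∈ : ∀ b → Gen G tuple (conjugate b)
    conjugate∈ b with occurs-in-rest b
    ... | t , t< , rest‼t≡ = subst (Gen G tuple) (trans eq rest‼t≡) (gen (fromℕ< position<n))
      where
      position<n : suc t * L < suc m
      position<n = subst (suc t * L <_) (sym n≡|T|) (*-monoˡ-< L (s≤s t<))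
      eq : tuple (fromℕ< position<n) ≡ rest ‼ t
      eq = trans (cong (T ‼_) (toℕ-fromℕ< position<n)) (layout-‼ (conjugate root ∷ rest) (suc t))

  tuple-∏≡ε : prod G tuple ≡ ε
  tuple-∏≡ε = trans (represents-prod tuple T tuple-represents-T) (∏-layout (conjugate root ∷ rest))

  braid-fixes-tuple : ∀ i → act G braid tuple i ≡ ε ∙ tuple i ∙ ε ⁻¹
  braid-fixes-tuple i = trans
    (act-toBraid-fixes m w w-bounded tuple T tuple-represents-T (proj₁ (proj₂ stabiliser)) i)
    (sym (trans (cong₂ _∙_ (identityˡ (tuple i)) ε⁻¹≈ε) (identityʳ (tuple i))))

  braid-cycle : IsNCycle (perm braid)
  braid-cycle = isNCycle-toBraid m w w-bounded
      (subst (IsCycleOn (permℕ w)) (sym n≡|T|) (proj₂ (proj₂ (proj₂ stabiliser))))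

mainTheorem20 : (G : FiniteGroup) → IsSimple G →
    (n : ℕ) → 0 < n → FiniteGroup.order G * FiniteGroup.order G ∣ n →
    Σ (Fin n → Fin (FiniteGroup.order G)) λ g → InSur1 G g ×
      Σ (Braid n) λ w →
        (∃ λ h → ∀ i → act G w g i ≡ FiniteGroup._∙_ G (FiniteGroup._∙_ G h (g i)) (FiniteGroup._⁻¹ G h))
        × IsNCycle (perm w)
mainTheorem20 G simple (suc m) _ (divides q n≡q*N²) =
  tuple , (tuple-generates , tuple-∏≡ε) , braid , (FiniteGroup.ε G , braid-fixes-tuple) , braid-cycle
  where open Construction G simple m q n≡q*N²
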